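{- Let $\Gamma$ be a connected strongly regular graph with parameters $(n,k,\lambda,\mu)$, and let $\theta_{\pm}=\frac{\lambda-\mu\pm\sqrt{(\lambda-\mu)^2-4(k-\mu)}}{2}$. If both $\frac{2\theta_+}{k}$ and $\frac{2\theta_- }{k}$ are algebraic integers, then $(n,k,\lambda,\mu)$ is one of $(2k,k,0,k)$, $(3\lambda,2\lambda,\lambda,2\lambda)$, or $(5,2,0,1)$.
   Context: Graphs are finite and simple. A graph is strongly regular with parameters $(n,k,\lambda,\mu)$ if it has $n$ vertices, is neither complete nor edgeless, is $k$-regular, any two adjacent vertices have exactly $\lambda$ common neighbours, and any two distinct non-adjacent vertices have exactly $\mu$ common neighbours. For a connected strongly regular graph, $\theta_\pm$ are its two adjacency eigenvalues other than $k$. A complex number is an algebraic integer if it is a root of a monic polynomial with integer coefficients. -}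

module Defs where

open import Data.Nat as ℕ using (ℕ; zero; suc)
open import Data.Integer as ℤ using (ℤ; +_)
open import Data.Rational as ℚ using (ℚ; 0ℚ; 1ℚ)
open import Data.Fin using (Fin)
open import Data.List using (List; []; _∷_; map; allFin)
open import Data.Nat.ListAction using (sum)
open import Data.Bool using (Bool; true; false; if_then_else_; _∧_)
open import Data.Product using (_×_; _,_; Σ; ∃; ∃-syntax)
open import Relation.Binary.PropositionalEquality using (_≡_; _≢_)
open import Relation.Nullary using (¬_)

record Graph (n : ℕ) : Set where
  field
    adj     : Fin n → Fin n → Bool
    adj-sym : ∀ u v → adj u v ≡ adj v u
    irrefl  : ∀ v → adj v v ≡ false
open Graph public

Adjacent : ∀ {n} → Graph n → Fin n → Fin n → Set
Adjacent G u v = adj G u v ≡ true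

count : ∀ {n} → (Fin n → Bool) → ℕ
count {n} P = sum (map (λ w → if P w then 1 else 0) (allFin n))

degree : ∀ {n} → Graph n → Fin n → ℕ
degree G v = count (λ w → adj G v w)

commonNbrs : ∀ {n} → Graph n → Fin n → Fin n → ℕ
commonNbrs G u v = count (λ w → adj G u w ∧ adj G v w)

record IsSRG {n : ℕ} (G : Graph n) (k l m : ℕ) : Set where
  field
    notComplete : ∃[ u ] ∃[ v ] (u ≢ v × ¬ Adjacent G u v)
    notEmpty    : ∃[ u ] ∃[ v ] Adjacent G u v
    regular     : ∀ v → degree G v ≡ k
    lambdaCond  : ∀ u v → Adjacent G u v → commonNbrs G u v ≡ l
    muCond      : ∀ u v → u ≢ v → ¬ Adjacent G u v → commonNbrs G u v ≡ m

data Walk {n : ℕ} (G : Graph n) : Fin n → Fin n → Set where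
  here : ∀ {v} → Walk G v v
  step : ∀ {u v w} → Adjacent G u v → Walk G v w → Walk G u w

Connected : ∀ {n} → Graph n → Set
Connected G = ∀ u v → Walk G u v

-- Real numbers of the form a + b·√D (a b ∈ ℚ, D ∈ ℤ with D ≥ 0),
-- represented by the pair (a , b).

QSqrt : Set
QSqrt = ℚ × ℚ

module _ (D : ℤ) where
  private Dq = D ℚ./ 1

  qfromℤ : ℤ → QSqrt
  qfromℤ c = (c ℚ./ 1 , 0ℚ)

  qadd : QSqrt → QSqrt → QSqrt
  qadd (a , b) (c , d) = (a ℚ.+ c , b ℚ.+ d)

  qmul : QSqrt → QSqrt → QSqrt
  qmul (a , b) (c , d) = (a ℚ.* c ℚ.+ (b ℚ.* d) ℚ.* Dq , a ℚ.* d ℚ.+ b ℚ.* c)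

  -- a + b√D = 0 as a real number (valid for D ≥ 0):
  -- a² = b²D and a·b ≤ 0
  IsZeroReal : QSqrt → Set
  IsZeroReal (a , b) = (a ℚ.* a ≡ (b ℚ.* b) ℚ.* Dq) × (a ℚ.* b) ℚ.≤ 0ℚ

  -- evaluation of the monic integer polynomial
  -- x^m + c_{m-1} x^{m-1} + … + c_0, given by [c_0, …, c_{m-1}]
  evalMonic : List ℤ → QSqrt → QSqrt
  evalMonic []       x = (1ℚ , 0ℚ)
  evalMonic (c ∷ cs) x = qadd (qfromℤ c) (qmul x (evalMonic cs x))

  IsAlgebraicInteger : QSqrt → Set
  IsAlgebraicInteger x = Σ (List ℤ) λ cs → IsZeroReal (evalMonic cs x)

disc : ℕ → ℕ → ℕ → ℤ
disc k l m = (+ l ℤ.- + m) ℤ.* (+ l ℤ.- + m) ℤ.- + 4 ℤ.* (+ k ℤ.- + m)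

-- a / k as a rational (k ≥ 1 for any SRG; value at k = 0 is irrelevant)
divNat : ℤ → ℕ → ℚ
divNat a zero    = 0ℚ
divNat a (suc k) = a ℚ./ suc k

-- 2θ₊/k = (λ-μ)/k + (1/k)√D   and   2θ₋/k = (λ-μ)/k - (1/k)√D
twoThetaPlusOverK : ℕ → ℕ → ℕ → QSqrt
twoThetaPlusOverK k l m = (divNat (+ l ℤ.- + m) k , divNat (+ 1) k)

twoThetaMinusOverK : ℕ → ℕ → ℕ → QSqrt
twoThetaMinusOverK k l m = (divNat (+ l ℤ.- + m) k , divNat (ℤ.- + 1) k)

-- Write c = λ − μ and D for the discriminant, so that 2θ± / k = (c ± √D) / k. If y / K is a root of a
-- monic integer polynomial of degree L, the values Σ rᵢ K^{L-1-i} yⁱ form a set stable under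
-- multiplication by y / K; hence Kⁿ divides yⁿ K^L for every n. When the monic relation for
-- (c + √D) / k holds in ℤ[√D], taking norms shows that k²ⁿ divides Nⁿ k^{2L} for N = c² − D = 4 (k − μ);
-- otherwise D = r² is a perfect square, and k divides both c + r and c − r, whose product is N. As
-- N grows only linearly in k, μ < k forces k² ≤ 4 (k − μ), so k = 2, μ = 1 and Γ is the pentagon.
-- If μ = k then D = (k − λ)² and k ∣ 2 (k − λ), which leaves the other two families. The counting
-- input is the identity k (k − λ − 1) = (n − k − 1) μ, and connectivity gives μ > 0.
module Submission where

open import Defs

module NaturalNumbers where

  open import Data.Nat
  open import Data.Nat.Properties
  open import Data.Nat.Divisibility using (_∣_; divides; ∣⇒≤)
  open import Data.Nat.Tactic.RingSolver using (solve-∀)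
  open import Data.Product using (_×_; _,_)
  open import Data.Sum as Sum using (_⊎_; inj₁; inj₂)
  open import Relation.Binary.PropositionalEquality
  open import Relation.Nullary using (yes; no)
  open import Relation.Nullary.Negation using (contradiction)

  bernoulli : ∀ a j → a ^ j * (a + j) ≤ suc a ^ j * a
  bernoulli a zero    = ≤-reflexive (+-identityʳ (a + 0))
  bernoulli a (suc j) = begin
    a * a ^ j * (a + suc j)                       ≤⟨ m≤m+n _ (a ^ j * j) ⟩
    a * a ^ j * (a + suc j) + a ^ j * j           ≡⟨ expand a j (a ^ j) ⟩
    suc a * (a ^ j * (a + j))                     ≤⟨ *-monoʳ-≤ (suc a) (bernoulli a j) ⟩
    suc a * (suc a ^ j * a)                       ≡⟨ *-assoc (suc a) (suc a ^ j) a ⟨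
    suc a * suc a ^ j * a                         ∎
    where
    open ≤-Reasoning
    expand : ∀ a j t → a * t * (a + suc j) + t * j ≡ suc a * (t * (a + j))
    expand = solve-∀

  -- Kⁿ ∣ aⁿ C bounds (K / a)ⁿ by C, whereas (1 + 1 / a)ⁿ is unbounded by Bernoulli's inequality.
  pow∣pow*⇒≤ : ∀ a {K} C .{{_ : NonZero a}} .{{_ : NonZero C}} → (∀ n → K ^ n ∣ a ^ n * C) → K ≤ a
  pow∣pow*⇒≤ a {K} C K^n∣ with K ≤? a
  ... | yes K≤a = K≤a
  ... | no  K≰a = contradiction (bernoulli a j) (<⇒≱ (begin-strict
        suc a ^ j * a       ≤⟨ *-monoˡ-≤ a (^-monoˡ-≤ j (≰⇒> K≰a)) ⟩
        K ^ j * a           ≤⟨ *-monoˡ-≤ a (∣⇒≤ (K^n∣ j)) ⟩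
        a ^ j * C * a       ≡⟨ *-assoc (a ^ j) C a ⟩
        a ^ j * (C * a)     <⟨ *-monoʳ-< (a ^ j) (m<n+m (C * a) (n≢0⇒n>0 (≢-nonZero⁻¹ a))) ⟩
        a ^ j * (a + C * a) ∎))
    where
    open ≤-Reasoning
    j = C * a
    instance
      a^j≢0 : NonZero (a ^ j)
      a^j≢0 = m^n≢0 a j
      a^jC≢0 : NonZero (a ^ j * C)
      a^jC≢0 = m*n≢0 (a ^ j) C

  params-μ<k : ∀ {n k l m ν} → n ≡ suc (k + ν) → 0 < ν → k * (k ∸ suc l) ≡ ν * m →
    0 < m → m < k → k * k ≤ 4 * (k ∸ m) → n ≡ 5 × k ≡ 2 × l ≡ 0 × m ≡ 1
  params-μ<k {k = 2} {zero} {1} {ν} n≡ _ 2≡ν _ _ _ =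
    trans n≡ (cong (λ t → suc (2 + t)) (trans (sym (*-identityʳ ν)) (sym 2≡ν))) , refl , refl , refl
  params-μ<k {k = 2} {suc l} {1} {ν} _ ν>0 eq _ _ _ =
    contradiction (trans (sym (*-identityʳ ν)) (trans (sym eq) (cong (2 *_) (0∸n≡0 l)))) (>⇒≢ ν>0)
  params-μ<k {k = 2} {m = suc (suc _)} _ _ _ _ (s≤s (s≤s ())) _
  params-μ<k {k = suc (suc (suc j))} {m = suc m} _ _ _ _ _ k²≤4[k∸μ] =
    contradiction k²≤4[k∸μ] (<⇒≱ (begin-strict
    4 * (suc (suc j) ∸ m)       ≤⟨ *-monoʳ-≤ 4 (m∸n≤m (suc (suc j)) m) ⟩
    4 * suc (suc j)             <⟨ m<m+n (4 * suc (suc j)) (s≤s z≤n) ⟩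
    4 * suc (suc j) + suc (j * j + 2 * j) ≡⟨ square j ⟩
    suc (suc (suc j)) * suc (suc (suc j)) ∎))
    where
    open ≤-Reasoning
    square : ∀ j → 4 * suc (suc j) + suc (j * j + 2 * j) ≡ suc (suc (suc j)) * suc (suc (suc j))
    square = solve-∀

  private
    twice : ∀ j → suc (suc j + j) ≡ 2 * suc j
    twice = solve-∀

    thrice : ∀ j → suc (suc (suc j + j) + j) ≡ 3 * suc j
    thrice = solve-∀

  -- For μ = k write k = 1 + λ + j, so that ν = j and k ∣ 2 (1 + j) leaves the quotients 1 and 2.
  quotient-cases : ∀ {n} l j q → n ≡ suc (suc (l + j) + j) → 2 * suc j ≡ q * suc (l + j) →
    (n ≡ 2 * suc (l + j) × l ≡ 0) ⊎ (n ≡ 3 * l × suc (l + j) ≡ 2 * l)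
  quotient-cases l j 1 n≡ 2[1+j]≡k = inj₂
    ( trans n≡ (trans (cong (λ t → suc (suc (t + j) + j)) l≡1+j) (trans (thrice j) (cong (3 *_) (sym l≡1+j))))
    , trans (cong (λ t → suc (t + j)) l≡1+j) (trans (twice j) (cong (2 *_) (sym l≡1+j))) )
    where
    l≡1+j : l ≡ suc j
    l≡1+j = +-cancelʳ-≡ j l (suc j)
      (suc-injective (trans (sym (*-identityˡ (suc (l + j)))) (trans (sym 2[1+j]≡k) (sym (twice j)))))
  quotient-cases l j 2 n≡ 2[1+j]≡2k = inj₁
    ( trans n≡ (trans (cong (λ t → suc (suc (t + j) + j)) l≡0)
                      (trans (twice j) (cong (λ t → 2 * suc (t + j)) (sym l≡0))))
    , l≡0 )
    where
    l≡0 : l ≡ 0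
    l≡0 = +-cancelʳ-≡ j l 0 (suc-injective (sym (*-cancelˡ-≡ (suc j) (suc (l + j)) 2 2[1+j]≡2k)))
  quotient-cases l j (suc (suc (suc q))) _ 2[1+j]≡qk = contradiction 2[1+j]≡qk (<⇒≢ (begin-strict
    2 * suc j                 <⟨ *-monoˡ-< (suc j) {2} {3} ≤-refl ⟩
    3 * suc j                 ≤⟨ *-monoʳ-≤ 3 (s≤s (m≤n+m j l)) ⟩
    3 * suc (l + j)           ≤⟨ *-monoˡ-≤ (suc (l + j)) {3} {suc (suc (suc q))} (s≤s (s≤s (s≤s z≤n))) ⟩
    suc (suc (suc q)) * suc (l + j) ∎))
    where open ≤-Reasoning

  params-μ≡k : ∀ {n k l m ν} → m ≡ k → n ≡ suc (k + ν) → k * (k ∸ suc l) ≡ ν * m → l < k →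
    k ∣ 2 * (k ∸ l) → (n ≡ 2 * k × l ≡ 0 × m ≡ k) ⊎ (n ≡ 3 * l × k ≡ 2 * l × m ≡ 2 * l)
  params-μ≡k {n} {k} {l} {ν = ν} refl n≡ k[k∸1+λ]≡νk l<k (divides q 2[k∸λ]≡qk) =
    Sum.map (λ (n≡2k , λ≡0) → n≡2k , λ≡0 , refl) (λ (n≡3λ , k≡2λ) → n≡3λ , k≡2λ , k≡2λ)
      (subst (λ k → (n ≡ 2 * k × l ≡ 0) ⊎ (n ≡ 3 * l × k ≡ 2 * l)) (sym k≡1+λ+j)
        (quotient-cases l j q (trans n≡ (cong₂ (λ k ν → suc (k + ν)) k≡1+λ+j ν≡j))
                             (trans (cong (2 *_) (sym k∸λ≡1+j)) (trans 2[k∸λ]≡qk (cong (q *_) k≡1+λ+j)))))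
    where
    j = k ∸ suc l
    k≡1+λ+j : k ≡ suc (l + j)
    k≡1+λ+j = sym (m+[n∸m]≡n l<k)
    k∸λ≡1+j : k ∸ l ≡ suc j
    k∸λ≡1+j = +-∸-assoc 1 l<k
    ν≡j : ν ≡ j
    ν≡j = sym (*-cancelˡ-≡ j ν k {{>-nonZero (<-≤-trans z<s l<k)}} (trans k[k∸1+λ]≡νk (*-comm ν k)))

open NaturalNumbers

module ScaledMonicPolynomials where

  open import Level using (_⊔_)
  open import Algebra.Bundles using (CommutativeRing)
  open import Data.Nat using (ℕ; zero; suc)
  open import Data.List using (List; []; _∷_; length; map)
  open import Data.List.Properties using (length-map)
  open import Data.Product using (_×_; _,_; ∃; ∃₂)
  import Relation.Binary.PropositionalEquality as ≡

  -- scaledMonic [c₀, …, c_{L-1}] = K^L p(y / K) for p = c₀ + c₁ X + ⋯ + c_{L-1} X^{L-1} + X^L,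
  -- computed without dividing by K.
  module ScaledMonic {c ℓ} (R : CommutativeRing c ℓ) (K y : CommutativeRing.Carrier R) where

    open CommutativeRing R
    open import Algebra.Properties.Semiring.Exp semiring public using (_^_)
    open import Algebra.Properties.Semiring.Exp semiring using (^-congˡ)
    open import Relation.Binary.Reasoning.Setoid setoid
    open import Algebra.Solver.Ring.NaturalCoefficients.Default commutativeSemiring

    scaledMonic : List Carrier → Carrier
    scaledMonic []       = 1#
    scaledMonic (a ∷ as) = a * K ^ suc (length as) + y * scaledMonic as

    -- Form p z: z = Σ_{i<p} rᵢ K^{p-1-i} yⁱ for some rᵢ ∈ R.
    data Form : ℕ → Carrier → Set (c ⊔ ℓ) where
      nil  : ∀ {z} → z ≈ 0# → Form 0 z
      cons : ∀ {p z w} d → Form p w → z ≈ d * K ^ p + y * w → Form (suc p) z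

    Form-0# : ∀ p → Form p 0#
    Form-0# zero    = nil refl
    Form-0# (suc p) = cons 0# (Form-0# p) (sym (trans (+-cong (zeroˡ (K ^ p)) (zeroʳ y)) (+-identityˡ 0#)))

    Form-+-* : ∀ {p a b} r → Form p a → Form p b → Form p (a + r * b)
    Form-+-* r (nil a≈0) (nil b≈0) = nil (trans (+-cong a≈0 (trans (*-congˡ b≈0) (zeroʳ r))) (+-identityˡ 0#))
    Form-+-* {suc p} r (cons d fv a≈) (cons e fw b≈) =
      cons (d + r * e) (Form-+-* r fv fw) (trans (+-cong a≈ (*-congˡ b≈)) (rearrange d e r (K ^ p) y _ _))
      where
      rearrange : ∀ d e r Kp y v w → (d * Kp + y * v) + r * (e * Kp + y * w) ≈ (d + r * e) * Kp + y * (v + r * w)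
      rearrange = solve 7 (λ d e r Kp y v w →
        (d :* Kp :+ y :* v) :+ r :* (e :* Kp :+ y :* w) := (d :+ r :* e) :* Kp :+ y :* (v :+ r :* w)) refl

    -- Adding a multiple of the monic form cancels the coefficient of y^L and leaves a multiple of K.
    Form-reduce : ∀ as {z} → Form (suc (length as)) z →
             ∃₂ λ e w → Form (length as) w × z + e * scaledMonic as ≈ K * w
    Form-reduce [] {z} _ = - z , 0# , nil refl , (begin
      z + - z * 1#  ≈⟨ +-congˡ (*-identityʳ (- z)) ⟩
      z + - z       ≈⟨ -‿inverseʳ z ⟩
      0#            ≈⟨ sym (zeroʳ K) ⟩
      K * 0#        ∎)
    Form-reduce (a ∷ as) {z} (cons {w = z′} d fz′ z≈) with Form-reduce as fz′
    ... | e , w , fw , z′+eH≈Kw = e , (d + e * a) * K ^ L + y * w , cons (d + e * a) fw refl , (begin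
      z + e * scaledMonic (a ∷ as)                         ≈⟨ +-congʳ z≈ ⟩
      d * (K * K ^ L) + y * z′ + e * (a * (K * K ^ L) + y * H)   ≈⟨ regroup d e a K (K ^ L) y _ H ⟩
      K * ((d + e * a) * K ^ L) + y * (z′ + e * H)         ≈⟨ +-congˡ (*-congˡ z′+eH≈Kw) ⟩
      K * ((d + e * a) * K ^ L) + y * (K * w)              ≈⟨ factor K ((d + e * a) * K ^ L) y w ⟩
      K * ((d + e * a) * K ^ L + y * w)                    ∎)
      where
      L = length as
      H = scaledMonic as
      regroup : ∀ d e a K Kp y z′ H →
        d * (K * Kp) + y * z′ + e * (a * (K * Kp) + y * H) ≈ K * ((d + e * a) * Kp) + y * (z′ + e * H)
      regroup = solve 8 (λ d e a K Kp y z′ H →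
        d :* (K :* Kp) :+ y :* z′ :+ e :* (a :* (K :* Kp) :+ y :* H)
        := K :* ((d :+ e :* a) :* Kp) :+ y :* (z′ :+ e :* H)) refl
      factor : ∀ K u y w → K * u + y * (K * w) ≈ K * (u + y * w)
      factor = solve 4 (λ K u y w → K :* u :+ y :* (K :* w) := K :* (u :+ y :* w)) refl

    K^length-Form : ∀ as → scaledMonic as ≈ 0# → Form (length as) (K ^ length as)
    K^length-Form []      root = nil root
    K^length-Form (_ ∷ _) _    = cons K (Form-0# _) (sym (trans (+-congˡ (zeroʳ y)) (+-identityʳ _)))

    module _ {as} (root : scaledMonic as ≈ 0#) where

      -- Multiplication by y / K preserves Form (length as): this is where the monic relation is used.
      y*-Form : ∀ {z} → Form (length as) z → ∃ λ w → Form (length as) w × y * z ≈ K * w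
      y*-Form {z} fz with Form-reduce as (cons 0# fz refl)
      ... | e , w , fw , eq = w , fw , (begin
        y * z                                       ≈⟨ +-identityˡ (y * z) ⟨
        0# + y * z                                  ≈⟨ +-congʳ (zeroˡ (K ^ length as)) ⟨
        0# * K ^ length as + y * z                  ≈⟨ +-identityʳ _ ⟨
        0# * K ^ length as + y * z + 0#             ≈⟨ +-congˡ (trans (*-congˡ root) (zeroʳ e)) ⟨
        0# * K ^ length as + y * z + e * scaledMonic as ≈⟨ eq ⟩
        K * w                                       ∎)

      [y+sK]*-Form : ∀ s {z} → Form (length as) z → ∃ λ w → Form (length as) w × (y + s * K) * z ≈ K * w
      [y+sK]*-Form s {z} fz with y*-Form fz
      ... | w , fw , yz≈Kw = w + s * z , Form-+-* s fw fz , (begin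
        (y + s * K) * z      ≈⟨ distribʳ z y (s * K) ⟩
        y * z + s * K * z    ≈⟨ +-cong yz≈Kw (regroup s K z) ⟩
        K * w + K * (s * z)  ≈⟨ sym (distribˡ K w (s * z)) ⟩
        K * (w + s * z)      ∎)
        where
        regroup : ∀ s K z → s * K * z ≈ K * (s * z)
        regroup = solve 3 (λ s K z → s :* K :* z := K :* (s :* z)) refl

      [y+sK]^n*-Form : ∀ s n {z} → Form (length as) z →
                       ∃ λ w → Form (length as) w × (y + s * K) ^ n * z ≈ K ^ n * w
      [y+sK]^n*-Form s zero {z} fz = z , fz , refl
      [y+sK]^n*-Form s (suc n) {z} fz with [y+sK]^n*-Form s n fz
      ... | w₁ , fw₁ , eq₁ with [y+sK]*-Form s fw₁
      ... | w₂ , fw₂ , eq₂ = w₂ , fw₂ , (begin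
        (Y * Y ^ n) * z     ≈⟨ *-assoc Y (Y ^ n) z ⟩
        Y * (Y ^ n * z)     ≈⟨ *-congˡ eq₁ ⟩
        Y * (K ^ n * w₁)    ≈⟨ x*[y*z]≈y*[x*z] Y (K ^ n) w₁ ⟩
        K ^ n * (Y * w₁)    ≈⟨ *-congˡ eq₂ ⟩
        K ^ n * (K * w₂)    ≈⟨ x*[y*z]≈y*[x*z] (K ^ n) K w₂ ⟩
        K * (K ^ n * w₂)    ≈⟨ sym (*-assoc K (K ^ n) w₂) ⟩
        (K * K ^ n) * w₂    ∎)
        where
        Y = y + s * K
        x*[y*z]≈y*[x*z] : ∀ x y z → x * (y * z) ≈ y * (x * z)
        x*[y*z]≈y*[x*z] = solve 3 (λ x y z → x :* (y :* z) := y :* (x :* z)) refl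

      shifted-bounded-denominators : ∀ s n → ∃ λ w → (y + s * K) ^ n * K ^ length as ≈ K ^ n * w
      shifted-bounded-denominators s n = let w , _ , eq = [y+sK]^n*-Form s n (K^length-Form as root) in w , eq

      bounded-denominators : ∀ n → ∃ λ w → y ^ n * K ^ length as ≈ K ^ n * w
      bounded-denominators n =
        let w , eq = shifted-bounded-denominators 0# n in w , trans (*-congʳ (^-congˡ n y≈y+0K)) eq
        where
        y≈y+0K : y ≈ y + 0# * K
        y≈y+0K = sym (trans (+-congˡ (zeroˡ K)) (+-identityʳ y))

  module _ {c ℓ} (R : CommutativeRing c ℓ) where

    open CommutativeRing R
    open ScaledMonic R using (scaledMonic)
    open import Algebra.Properties.Semiring.Exp semiring using (_^_; ^-congˡ)
    open import Algebra.Properties.CommutativeSemiring.Exp commutativeSemiring using (^-distrib-*)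
    open import Relation.Binary.Reasoning.Setoid setoid
    open import Algebra.Solver.Ring.NaturalCoefficients.Default commutativeSemiring

    scaledMonic-homogeneous : ∀ t {K y K′ y′} → K′ ≈ t * K → y′ ≈ t * y → ∀ as →
      scaledMonic K′ y′ as ≈ t ^ length as * scaledMonic K y as
    scaledMonic-homogeneous t K′≈ y′≈ [] = sym (*-identityˡ 1#)
    scaledMonic-homogeneous t {K} {y} {K′} {y′} K′≈ y′≈ (a ∷ as) = begin
      a * K′ ^ suc L + y′ * scaledMonic K′ y′ as
        ≈⟨ +-cong (*-congˡ (trans (^-congˡ (suc L) K′≈) (^-distrib-* t K (suc L))))
                  (*-cong y′≈ (scaledMonic-homogeneous t K′≈ y′≈ as)) ⟩
      a * ((t * t ^ L) * (K * K ^ L)) + (t * y) * (t ^ L * scaledMonic K y as)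
        ≈⟨ regroup a t (t ^ L) K (K ^ L) y _ ⟩
      (t * t ^ L) * (a * (K * K ^ L) + y * scaledMonic K y as) ∎
      where
      L = length as
      regroup : ∀ a t tL K KL y H → a * ((t * tL) * (K * KL)) + (t * y) * (tL * H) ≈ (t * tL) * (a * (K * KL) + y * H)
      regroup = solve 7 (λ a t tL K KL y H →
        a :* ((t :* tL) :* (K :* KL)) :+ (t :* y) :* (tL :* H) := (t :* tL) :* (a :* (K :* KL) :+ y :* H)) refl

  module _ {c₁ ℓ₁ c₂ ℓ₂} (R : CommutativeRing c₁ ℓ₁) (S : CommutativeRing c₂ ℓ₂) where

    private
      module R = CommutativeRing R
      module S = CommutativeRing S

    module RingHomomorphism
      (f : R.Carrier → S.Carrier)
      (+-homo : ∀ a b → f (a R.+ b) S.≈ f a S.+ f b)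
      (*-homo : ∀ a b → f (a R.* b) S.≈ f a S.* f b)
      (1#-homo : f R.1# S.≈ S.1#)
      where

      open import Algebra.Properties.Semiring.Exp R.semiring using () renaming (_^_ to _^ᴿ_)
      open import Algebra.Properties.Semiring.Exp S.semiring using (_^_)
      open import Relation.Binary.Reasoning.Setoid S.setoid
      open ScaledMonic using (scaledMonic)

      ^-homo : ∀ a n → f (a ^ᴿ n) S.≈ f a ^ n
      ^-homo a zero    = 1#-homo
      ^-homo a (suc n) = S.trans (*-homo a (a ^ᴿ n)) (S.*-congˡ (^-homo a n))

      scaledMonic-homo : ∀ K y as → f (scaledMonic R K y as) S.≈ scaledMonic S (f K) (f y) (map f as)
      scaledMonic-homo K y []       = 1#-homo
      scaledMonic-homo K y (a ∷ as) = begin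
        f (a R.* K ^ᴿ suc (length as) R.+ y R.* scaledMonic R K y as)
          ≈⟨ S.trans (+-homo _ _) (S.+-cong (*-homo a (K ^ᴿ suc (length as))) (*-homo y (scaledMonic R K y as))) ⟩
        f a S.* f (K ^ᴿ suc (length as)) S.+ f y S.* f (scaledMonic R K y as)
          ≈⟨ S.+-cong (S.*-congˡ (S.trans (^-homo K (suc (length as)))
                                          (S.reflexive (≡.cong (λ n → f K ^ suc n) (≡.sym (length-map f as))))))
                      (S.*-congˡ (scaledMonic-homo K y as)) ⟩
        f a S.* f K ^ suc (length (map f as)) S.+ f y S.* scaledMonic S (f K) (f y) (map f as) ∎

open ScaledMonicPolynomials

module QuadraticExtensions where

  open import Algebra.Bundles using (CommutativeRing)
  open import Algebra.Structures using (IsCommutativeRing)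
  open import Data.Product using (_×_; _,_)

  -- R[√D] = R × R, the pair (a , b) standing for a + b √D.
  module Adjoin√ {c ℓ} (R : CommutativeRing c ℓ) (D : CommutativeRing.Carrier R) where

    open CommutativeRing R
    open import Algebra.Solver.Ring.NaturalCoefficients.Default commutativeSemiring

    R[√D] : Set c
    R[√D] = Carrier × Carrier

    infix  4 _≋_
    infixl 6 _⊕_
    infixl 7 _⊛_

    _≋_ : R[√D] → R[√D] → Set ℓ
    (a , b) ≋ (a′ , b′) = a ≈ a′ × b ≈ b′

    _⊕_ _⊛_ : R[√D] → R[√D] → R[√D]
    (a , b) ⊕ (c , d) = (a + c , b + d)
    (a , b) ⊛ (c , d) = (a * c + b * d * D , a * d + b * c)

    ⊝_ : R[√D] → R[√D]
    ⊝ (a , b) = (- a , - b)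

    𝟘 𝟙 : R[√D]
    𝟘 = (0# , 0#)
    𝟙 = (1# , 0#)

    +-*-isCommutativeRing : IsCommutativeRing _≋_ _⊕_ _⊛_ ⊝_ 𝟘 𝟙
    +-*-isCommutativeRing = record
      { isRing = record
        { +-isAbelianGroup = record
          { isGroup = record
            { isMonoid = record
              { isSemigroup = record
                { isMagma = record
                  { isEquivalence = record
                    { refl  = refl , refl
                    ; sym   = λ (p , q) → sym p , sym q
                    ; trans = λ (p , q) (p′ , q′) → trans p p′ , trans q q′ }
                  ; ∙-cong = λ (p , q) (p′ , q′) → +-cong p p′ , +-cong q q′ }
                ; assoc = λ (a , b) (c , d) (e , f) → +-assoc a c e , +-assoc b d f }
              ; identity = (λ (a , b) → +-identityˡ a , +-identityˡ b)
                         , (λ (a , b) → +-identityʳ a , +-identityʳ b) }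
            ; inverse = (λ (a , b) → -‿inverseˡ a , -‿inverseˡ b)
                      , (λ (a , b) → -‿inverseʳ a , -‿inverseʳ b)
            ; ⁻¹-cong = λ (p , q) → -‿cong p , -‿cong q }
          ; comm = λ (a , b) (c , d) → +-comm a c , +-comm b d }
        ; *-cong = λ (p , q) (p′ , q′) →
            +-cong (*-cong p p′) (*-cong (*-cong q q′) refl) , +-cong (*-cong p q′) (*-cong q p′)
        ; *-assoc = λ (a , b) (c , d) (e , f) →
            solve 7 (λ a b c d e f D →
              (a :* c :+ b :* d :* D) :* e :+ (a :* d :+ b :* c) :* f :* D
              := a :* (c :* e :+ d :* f :* D) :+ b :* (c :* f :+ d :* e) :* D) refl a b c d e f D ,
            solve 7 (λ a b c d e f D →
              (a :* c :+ b :* d :* D) :* f :+ (a :* d :+ b :* c) :* e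
              := a :* (c :* f :+ d :* e) :+ b :* (c :* e :+ d :* f :* D)) refl a b c d e f D
        ; *-identity =
            (λ (a , b) →
              solve 3 (λ a b D → con 1 :* a :+ con 0 :* b :* D := a) refl a b D ,
              solve 2 (λ a b → con 1 :* b :+ con 0 :* a := b) refl a b) ,
            (λ (a , b) →
              solve 3 (λ a b D → a :* con 1 :+ b :* con 0 :* D := a) refl a b D ,
              solve 2 (λ a b → a :* con 0 :+ b :* con 1 := b) refl a b)
        ; distrib =
            (λ (a , b) (c , d) (e , f) →
              solve 7 (λ a b c d e f D →
                a :* (c :+ e) :+ b :* (d :+ f) :* D := (a :* c :+ b :* d :* D) :+ (a :* e :+ b :* f :* D))
                refl a b c d e f D ,
              solve 6 (λ a b c d e f →
                a :* (d :+ f) :+ b :* (c :+ e) := (a :* d :+ b :* c) :+ (a :* f :+ b :* e)) refl a b c d e f) ,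
            (λ (a , b) (c , d) (e , f) →
              solve 7 (λ a b c d e f D →
                (c :+ e) :* a :+ (d :+ f) :* b :* D := (c :* a :+ d :* b :* D) :+ (e :* a :+ f :* b :* D))
                refl a b c d e f D ,
              solve 6 (λ a b c d e f →
                (c :+ e) :* b :+ (d :+ f) :* a := (c :* b :+ d :* a) :+ (e :* b :+ f :* a)) refl a b c d e f) }
      ; *-comm = λ (a , b) (c , d) →
          solve 5 (λ a b c d D → a :* c :+ b :* d :* D := c :* a :+ d :* b :* D) refl a b c d D ,
          solve 4 (λ a b c d → a :* d :+ b :* c := c :* b :+ d :* a) refl a b c d }

    +-*-commutativeRing : CommutativeRing c ℓ
    +-*-commutativeRing = record { isCommutativeRing = +-*-isCommutativeRing }

open QuadraticExtensions

module IntegerPowers where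

  open import Algebra.Bundles using (CommutativeRing)
  open import Data.Nat as ℕ using (zero; suc)
  open import Data.Integer as ℤ using (+_; ∣_∣)
  import Data.Integer.Properties as ℤ
  open import Relation.Binary.PropositionalEquality
  open import Algebra.Properties.Semiring.Exp (CommutativeRing.semiring ℤ.+-*-commutativeRing) public
    using () renaming (_^_ to _^ℤ_)

  pos-^ : ∀ m n → (+ m) ^ℤ n ≡ + (m ℕ.^ n)
  pos-^ m zero    = refl
  pos-^ m (suc n) = trans (cong (+ m ℤ.*_) (pos-^ m n)) (sym (ℤ.pos-* m (m ℕ.^ n)))

  abs-^ : ∀ i n → ∣ i ^ℤ n ∣ ≡ ∣ i ∣ ℕ.^ n
  abs-^ i zero    = refl
  abs-^ i (suc n) = trans (ℤ.abs-* i (i ^ℤ n)) (cong (∣ i ∣ ℕ.*_) (abs-^ i n))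

open IntegerPowers

module RationalEmbedding where

  open import Data.Nat using (suc)
  open import Data.Integer as ℤ using (ℤ; +_)
  import Data.Integer.Properties as ℤ
  open import Data.Integer.GCD using (gcd)
  open import Data.Integer.Tactic.RingSolver using (solve-∀)
  open import Data.Rational as ℚ using (ℚ; 0ℚ; mkℚ; ↥_; ↧_; toℚᵘ)
  import Data.Rational.Properties as ℚ
  import Data.Rational.Unnormalised as ℚᵘ
  import Data.Rational.Unnormalised.Properties as ℚᵘ
  open import Relation.Binary.PropositionalEquality

  ι : ℤ → ℚ
  ι i = i ℚ./ 1

  toℚᵘ-/ : ∀ i n → toℚᵘ (i ℚ./ suc n) ℚᵘ.≃ ℚᵘ.mkℚᵘ i n
  toℚᵘ-/ i n = ℚᵘ.*≡* (go (i ℚ./ suc n) refl)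
    where
    go : ∀ p → p ≡ i ℚ./ suc n → ℚᵘ.↥ (toℚᵘ p) ℤ.* + suc n ≡ i ℤ.* ℚᵘ.↧ (toℚᵘ p)
    go (mkℚ a b _) p≡ = begin
      a ℤ.* + suc n                  ≡⟨ cong (a ℤ.*_) (sym b*g≡) ⟩
      a ℤ.* (+ suc b ℤ.* g)          ≡⟨ regroup a (+ suc b) g ⟩
      a ℤ.* g ℤ.* + suc b            ≡⟨ cong (ℤ._* + suc b) a*g≡ ⟩
      i ℤ.* + suc b                  ∎
      where
      open ≡-Reasoning
      g = gcd i (+ suc n)
      a*g≡ : a ℤ.* g ≡ i
      a*g≡ = trans (cong (λ q → ↥ q ℤ.* g) p≡) (ℚ.↥-/ i (suc n))
      b*g≡ : + suc b ℤ.* g ≡ + suc n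
      b*g≡ = trans (cong (λ q → ↧ q ℤ.* g) p≡) (ℚ.↧-/ i (suc n))
      regroup : ∀ x y z → x ℤ.* (y ℤ.* z) ≡ x ℤ.* z ℤ.* y
      regroup = solve-∀

  ι-+ : ∀ i j → ι (i ℤ.+ j) ≡ ι i ℚ.+ ι j
  ι-+ i j = ℚ.toℚᵘ-injective (ℚᵘ.≃-trans (toℚᵘ-/ (i ℤ.+ j) 0) (ℚᵘ.≃-sym (ℚᵘ.≃-trans
    (ℚ.toℚᵘ-homo-+ (ι i) (ι j)) (ℚᵘ.≃-trans (ℚᵘ.+-cong (toℚᵘ-/ i 0) (toℚᵘ-/ j 0)) (ℚᵘ.*≡* (eq i j))))))
    where
    eq : ∀ i j → (i ℤ.* + 1 ℤ.+ j ℤ.* + 1) ℤ.* + 1 ≡ (i ℤ.+ j) ℤ.* + 1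
    eq = solve-∀

  ι-* : ∀ i j → ι (i ℤ.* j) ≡ ι i ℚ.* ι j
  ι-* i j = ℚ.toℚᵘ-injective (ℚᵘ.≃-trans (toℚᵘ-/ (i ℤ.* j) 0) (ℚᵘ.≃-sym (ℚᵘ.≃-trans
    (ℚ.toℚᵘ-homo-* (ι i) (ι j)) (ℚᵘ.*-cong (toℚᵘ-/ i 0) (toℚᵘ-/ j 0)))))

  ι-*-/ : ∀ i n → ι (+ suc n) ℚ.* (i ℚ./ suc n) ≡ ι i
  ι-*-/ i n = ℚ.toℚᵘ-injective (ℚᵘ.≃-trans (ℚ.toℚᵘ-homo-* (ι (+ suc n)) (i ℚ./ suc n))
    (ℚᵘ.≃-trans (ℚᵘ.*-cong (toℚᵘ-/ (+ suc n) 0) (toℚᵘ-/ i n))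
    (ℚᵘ.≃-trans (ℚᵘ.*≡* (eq i (+ suc n))) (ℚᵘ.≃-sym (toℚᵘ-/ i 0)))))
    where
    eq : ∀ i k → k ℤ.* i ℤ.* + 1 ≡ i ℤ.* (+ 1 ℤ.* k)
    eq = solve-∀

  ι-injective : ∀ {i j} → ι i ≡ ι j → i ≡ j
  ι-injective {i} {j} ιi≡ιj
    with ℚᵘ.≃-trans (ℚᵘ.≃-sym (toℚᵘ-/ i 0)) (ℚᵘ.≃-trans (ℚ.toℚᵘ-cong ιi≡ιj) (toℚᵘ-/ j 0))
  ... | ℚᵘ.*≡* eq = trans (sym (ℤ.*-identityʳ i)) (trans eq (ℤ.*-identityʳ j))

  ι-cancel-≤0 : ∀ {i} → ι i ℚ.≤ 0ℚ → i ℤ.≤ + 0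
  ι-cancel-≤0 {i} ιi≤0 with ℚᵘ.≤-respˡ-≃ (toℚᵘ-/ i 0) (ℚ.toℚᵘ-mono-≤ ιi≤0)
  ... | ℚᵘ.*≤* le = subst (ℤ._≤ + 0) (ℤ.*-identityʳ i) le

  ι-nonNeg : ∀ n → ℚ.NonNegative (ι (+ n))
  ι-nonNeg n = ℚ.normalize-nonNeg n 1

  ι-0 : ι (+ 0) ≡ 0ℚ
  ι-0 = ℚ.0/n≡0 1
open RationalEmbedding

module ClearingDenominators where

  open import Algebra.Bundles using (CommutativeRing)
  open import Data.Nat as ℕ using (ℕ; zero; suc)
  open import Data.Integer as ℤ using (ℤ; +_)
  import Data.Integer.Properties as ℤ
  open import Data.Integer.Tactic.RingSolver using (solve-∀)
  open import Data.Rational as ℚ using (0ℚ)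
  import Data.Rational.Properties as ℚ
  open import Data.List using (List; []; _∷_; length; map)
  open import Data.List.Properties using (length-map)
  open import Data.Product using (_×_; _,_; proj₁; proj₂)
  open import Data.Product.Properties using (×-≡,≡→≡)
  open import Relation.Binary.PropositionalEquality as ≡ using (_≡_)

  IsZeroRealℤ : ℤ → ℤ × ℤ → Set
  IsZeroRealℤ D (b , a) = b ℤ.* b ≡ a ℤ.* a ℤ.* D × b ℤ.* a ℤ.≤ + 0

  IsZeroReal-scale : ∀ D q {a b} → ℚ.NonNegative q → IsZeroReal D (a , b) → IsZeroReal D (q ℚ.* a , q ℚ.* b)
  IsZeroReal-scale D q {a} {b} q≥0 (a²≡b²D , ab≤0) =
    (begin-equality
      (q ℚ.* a) ℚ.* (q ℚ.* a)              ≡⟨ square q a ⟩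
      (q ℚ.* q) ℚ.* (a ℚ.* a)              ≡⟨ ≡.cong ((q ℚ.* q) ℚ.*_) a²≡b²D ⟩
      (q ℚ.* q) ℚ.* ((b ℚ.* b) ℚ.* ι D)    ≡⟨ rescale q b (ι D) ⟩
      ((q ℚ.* b) ℚ.* (q ℚ.* b)) ℚ.* ι D    ∎) ,
    (begin
      (q ℚ.* a) ℚ.* (q ℚ.* b)              ≡⟨ product q a b ⟩
      (q ℚ.* q) ℚ.* (a ℚ.* b)              ≤⟨ ℚ.*-monoˡ-≤-nonNeg (q ℚ.* q) ab≤0 ⟩
      (q ℚ.* q) ℚ.* 0ℚ                     ≡⟨ ℚ.*-zeroʳ (q ℚ.* q) ⟩
      0ℚ                                   ∎)
    where
    open ℚ.≤-Reasoning
    instance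
      q²≥0 : ℚ.NonNegative (q ℚ.* q)
      q²≥0 = ℚ.nonNeg*nonNeg⇒nonNeg q {{q≥0}} q {{q≥0}}
    open import Data.Rational.Solver
    open +-*-Solver using (_:*_; _:=_; solve)
    square : ∀ q a → (q ℚ.* a) ℚ.* (q ℚ.* a) ≡ (q ℚ.* q) ℚ.* (a ℚ.* a)
    square = solve 2 (λ q a → (q :* a) :* (q :* a) := (q :* q) :* (a :* a)) ≡.refl
    rescale : ∀ q b d → (q ℚ.* q) ℚ.* ((b ℚ.* b) ℚ.* d) ≡ ((q ℚ.* b) ℚ.* (q ℚ.* b)) ℚ.* d
    rescale = solve 3 (λ q b d → (q :* q) :* ((b :* b) :* d) := ((q :* b) :* (q :* b)) :* d) ≡.refl
    product : ∀ q a b → (q ℚ.* a) ℚ.* (q ℚ.* b) ≡ (q ℚ.* q) ℚ.* (a ℚ.* b)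
    product = solve 3 (λ q a b → (q :* a) :* (q :* b) := (q :* q) :* (a :* b)) ≡.refl

  IsZeroReal-ι : ∀ D B A → IsZeroReal D (ι B , ι A) → IsZeroRealℤ D (B , A)
  IsZeroReal-ι D B A (B²≡A²D , BA≤0) =
    ι-injective (≡.trans (ι-* B B) (≡.trans B²≡A²D
      (≡.sym (≡.trans (ι-* (A ℤ.* A) D) (≡.cong (ℚ._* ι D) (ι-* A A)))))) ,
    ι-cancel-≤0 (≡.subst (ℚ._≤ 0ℚ) (≡.sym (ι-* B A)) BA≤0)

  fromℤ : ℤ → ℤ × ℤ
  fromℤ a = (a , + 0)

  module _ (D : ℤ) where

    module ℤ√ = Adjoin√ ℤ.+-*-commutativeRing D
    module ℚ√ = Adjoin√ ℚ.+-*-commutativeRing (ι D)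
    open CommutativeRing ℚ√.+-*-commutativeRing using (_≈_; setoid; *-congˡ; *-congʳ; *-identityʳ; +-cong)
      renaming (sym to ≈-sym; trans to ≈-trans; refl to ≈-refl)
    open import Algebra.Properties.Semiring.Exp (CommutativeRing.semiring ℚ√.+-*-commutativeRing) using (_^_)
    open ScaledMonic using (scaledMonic)

    ι√ : ℤ × ℤ → QSqrt
    ι√ (a , b) = (ι a , ι b)

    ι√-+ : ∀ u v → ι√ (u ℤ√.⊕ v) ℚ√.≋ ι√ u ℚ√.⊕ ι√ v
    ι√-+ (a , b) (c , d) = ι-+ a c , ι-+ b d

    ι√-* : ∀ u v → ι√ (u ℤ√.⊛ v) ℚ√.≋ ι√ u ℚ√.⊛ ι√ v
    ι√-* (a , b) (c , d) =
      ≡.trans (ι-+ (a ℤ.* c) _)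
              (≡.cong₂ ℚ._+_ (ι-* a c) (≡.trans (ι-* (b ℤ.* d) D) (≡.cong (ℚ._* ι D) (ι-* b d)))) ,
      ≡.trans (ι-+ (a ℤ.* d) _) (≡.cong₂ ℚ._+_ (ι-* a d) (ι-* b c))

    ι√-1 : ι√ ℤ√.𝟙 ℚ√.≋ ℚ√.𝟙
    ι√-1 = ≡.refl , ι-0

    fromℤ-* : ∀ a b → fromℤ (a ℤ.* b) ℤ√.≋ fromℤ a ℤ√.⊛ fromℤ b
    fromℤ-* a b = eq₁ a b D , eq₂ a b
      where
      eq₁ : ∀ a b D → a ℤ.* b ≡ a ℤ.* b ℤ.+ + 0 ℤ.* + 0 ℤ.* D
      eq₁ = solve-∀
      eq₂ : ∀ a b → + 0 ≡ a ℤ.* + 0 ℤ.+ + 0 ℤ.* b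
      eq₂ = solve-∀

    private
      ℤ√-ring = ℤ√.+-*-commutativeRing
      ℚ√-ring = ℚ√.+-*-commutativeRing

    open RingHomomorphism ℤ√-ring ℚ√-ring ι√ ι√-+ ι√-* ι√-1
      renaming (^-homo to ι√-^; scaledMonic-homo to ι√-scaledMonic)
    open RingHomomorphism ℤ.+-*-commutativeRing ℤ√-ring fromℤ (λ _ _ → ≡.refl , ≡.refl) fromℤ-* (≡.refl , ≡.refl)
      renaming (^-homo to fromℤ-^)
    open import Relation.Binary.Reasoning.Setoid setoid
    open import Algebra.Properties.Semiring.Exp (CommutativeRing.semiring ℤ√-ring) using () renaming (_^_ to _ℤ√^_)

    𝟙^n≈𝟙 : ∀ n → ℚ√.𝟙 ^ n ≈ ℚ√.𝟙
    𝟙^n≈𝟙 zero    = ≈-refl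
    𝟙^n≈𝟙 (suc n) = begin
      ℚ√.𝟙 ℚ√.⊛ ℚ√.𝟙 ^ n  ≈⟨ *-congˡ {ℚ√.𝟙} (𝟙^n≈𝟙 n) ⟩
      ℚ√.𝟙 ℚ√.⊛ ℚ√.𝟙      ≈⟨ *-identityʳ ℚ√.𝟙 ⟩
      ℚ√.𝟙                ∎

    evalMonic≈scaledMonic : ∀ x cs → evalMonic D cs x ≈ scaledMonic ℚ√-ring ℚ√.𝟙 x (map ι√ (map fromℤ cs))
    evalMonic≈scaledMonic x []       = ≈-refl
    evalMonic≈scaledMonic x (c ∷ cs) = begin
      qfromℤ D c ℚ√.⊕ x ℚ√.⊛ evalMonic D cs x
        ≈⟨ +-cong coefficient (*-congˡ {x} (evalMonic≈scaledMonic x cs)) ⟩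
      ι√ (fromℤ c) ℚ√.⊛ ℚ√.𝟙 ^ suc L ℚ√.⊕ x ℚ√.⊛ scaledMonic ℚ√-ring ℚ√.𝟙 x (map ι√ (map fromℤ cs)) ∎
      where
      L = length (map ι√ (map fromℤ cs))
      coefficient : qfromℤ D c ≈ ι√ (fromℤ c) ℚ√.⊛ ℚ√.𝟙 ^ suc L
      coefficient = begin
        qfromℤ D c                          ≈⟨ ≡.refl , ≡.sym ι-0 ⟩
        ι√ (fromℤ c)                        ≈⟨ *-identityʳ (ι√ (fromℤ c)) ⟨
        ι√ (fromℤ c) ℚ√.⊛ ℚ√.𝟙              ≈⟨ *-congˡ {ι√ (fromℤ c)} (𝟙^n≈𝟙 (suc L)) ⟨
        ι√ (fromℤ c) ℚ√.⊛ ℚ√.𝟙 ^ suc L      ∎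

    ι0*≡0 : ∀ a → ι (+ 0) ℚ.* a ≡ 0ℚ
    ι0*≡0 a = ≡.trans (≡.cong (ℚ._* a) ι-0) (ℚ.*-zeroˡ a)

    ι√∘fromℤ-⊛ : ∀ i u → ι√ (fromℤ i) ℚ√.⊛ u ≈ (ι i ℚ.* proj₁ u , ι i ℚ.* proj₂ u)
    ι√∘fromℤ-⊛ i (a , b) =
      ≡.trans (≡.cong (ι i ℚ.* a ℚ.+_) (≡.trans (≡.cong (ℚ._* ι D) (ι0*≡0 b)) (ℚ.*-zeroˡ (ι D))))
              (ℚ.+-identityʳ _) ,
      ≡.trans (≡.cong (ι i ℚ.* b ℚ.+_) (ι0*≡0 a)) (ℚ.+-identityʳ _)

    ι√-cong : ∀ {u v} → u ℤ√.≋ v → ι√ u ≈ ι√ v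
    ι√-cong (p , q) = ≡.cong ι p , ≡.cong ι q

    module _ (k : ℕ) (c e : ℤ) (cs : List ℤ) where

      private
        K = fromℤ (+ suc k)
        x = (c ℚ./ suc k , e ℚ./ suc k)

      -- K^L p(x) for x = (c + e √D) / K; it lies in ℤ[√D].
      scaled : ℤ × ℤ
      scaled = scaledMonic ℤ√-ring K (c , e) (map fromℤ cs)

      ι√-scaled : ι√ scaled ≈ ι√ (fromℤ ((+ suc k) ^ℤ length cs)) ℚ√.⊛ evalMonic D cs x
      ι√-scaled = begin
        ι√ scaled
          ≈⟨ ι√-scaledMonic K (c , e) (map fromℤ cs) ⟩
        scaledMonic ℚ√-ring (ι√ K) (ι√ (c , e)) (map ι√ (map fromℤ cs))
          ≈⟨ scaledMonic-homogeneous ℚ√-ring (ι√ K) (≈-sym (*-identityʳ (ι√ K))) ι√[c,e]≈ (map ι√ (map fromℤ cs)) ⟩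
        ι√ K ^ L ℚ√.⊛ scaledMonic ℚ√-ring ℚ√.𝟙 x (map ι√ (map fromℤ cs))
          ≈⟨ *-congʳ {scaledMonic ℚ√-ring ℚ√.𝟙 x (map ι√ (map fromℤ cs))} Kᴸ≈ ⟩
        ι√ (fromℤ ((+ suc k) ^ℤ length cs)) ℚ√.⊛ scaledMonic ℚ√-ring ℚ√.𝟙 x (map ι√ (map fromℤ cs))
          ≈⟨ *-congˡ {ι√ (fromℤ ((+ suc k) ^ℤ length cs))} (evalMonic≈scaledMonic x cs) ⟨
        ι√ (fromℤ ((+ suc k) ^ℤ length cs)) ℚ√.⊛ evalMonic D cs x ∎
        where
        L = length (map ι√ (map fromℤ cs))
        ι√[c,e]≈ : ι√ (c , e) ≈ ι√ K ℚ√.⊛ x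
        ι√[c,e]≈ =
          ≡.sym (≡.trans (≡.cong (ι (+ suc k) ℚ.* (c ℚ./ suc k) ℚ.+_)
                                 (≡.trans (≡.cong (ℚ._* ι D) (ι0*≡0 (e ℚ./ suc k))) (ℚ.*-zeroˡ (ι D))))
                         (≡.trans (ℚ.+-identityʳ _) (ι-*-/ c k))) ,
          ≡.sym (≡.trans (≡.cong (ι (+ suc k) ℚ.* (e ℚ./ suc k) ℚ.+_) (ι0*≡0 (c ℚ./ suc k)))
                         (≡.trans (ℚ.+-identityʳ _) (ι-*-/ e k)))
        Kᴸ≈ : ι√ K ^ L ≈ ι√ (fromℤ ((+ suc k) ^ℤ length cs))
        Kᴸ≈ = begin
          ι√ K ^ L
            ≡⟨ ≡.cong (ι√ K ^_) (≡.trans (length-map ι√ (map fromℤ cs)) (length-map fromℤ cs)) ⟩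
          ι√ K ^ length cs
            ≈⟨ ι√-^ K (length cs) ⟨
          ι√ (K ℤ√^ length cs)
            ≈⟨ ι√-cong (CommutativeRing.sym ℤ√-ring (fromℤ-^ (+ suc k) (length cs))) ⟩
          ι√ (fromℤ ((+ suc k) ^ℤ length cs)) ∎

      IsZeroRealℤ-scaled : IsZeroReal D (evalMonic D cs x) → IsZeroRealℤ D scaled
      IsZeroRealℤ-scaled zero-E =
        IsZeroReal-ι D (proj₁ scaled) (proj₂ scaled)
          (≡.subst (IsZeroReal D) (×-≡,≡→≡ (≈-sym ι√-scaled′)) (IsZeroReal-scale D q q≥0 zero-E))
        where
        q = ι ((+ suc k) ^ℤ length cs)
        q≥0 : ℚ.NonNegative q
        q≥0 = ≡.subst (λ i → ℚ.NonNegative (ι i)) (≡.sym (pos-^ (suc k) (length cs)))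
                      (ι-nonNeg (suc k ℕ.^ length cs))
        ι√-scaled′ : ι√ scaled ≈ (q ℚ.* proj₁ (evalMonic D cs x) , q ℚ.* proj₂ (evalMonic D cs x))
        ι√-scaled′ = ≈-trans ι√-scaled (ι√∘fromℤ-⊛ ((+ suc k) ^ℤ length cs) (evalMonic D cs x))

open ClearingDenominators

module IntegralityBounds where

  open import Algebra.Bundles using (CommutativeRing)
  open import Data.Nat as ℕ using (ℕ; zero; suc; NonZero; ≢-nonZero)
  import Data.Nat.Properties as ℕ
  import Data.Nat.Divisibility as ℕ
  open import Data.Nat.DivMod using (_/_; m/n*n≡m)
  open import Data.Nat.GCD using (gcd; gcd[m,n]∣m; gcd[m,n]∣n; gcd[m,n]≡0⇒m≡0)
  open import Data.Nat.Coprimality using (coprime-/gcd; coprime-divisor)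
  open import Data.Nat.Tactic.RingSolver using () renaming (solve-∀ to ℕ-solve-∀)
  open import Data.Integer as ℤ using (ℤ; +_; -[1+_]; ∣_∣)
  import Data.Integer.Properties as ℤ
  open import Data.Integer.Divisibility using (_∣_)
  open import Data.Integer.DivMod using (_%ℕ_; _/ℕ_; n%ℕd<d; a≡a%ℕn+[a/ℕn]*n)
  open import Data.Integer.Tactic.RingSolver using (solve-∀)
  import Data.Rational as ℚ
  open import Data.Empty using (⊥-elim)
  open import Data.List using (map; length)
  open import Data.List.Properties using (map-∘; map-cong; map-id)
  open import Data.Product using (_×_; _,_; proj₁; proj₂; ∃)
  open import Data.Sum using ([_,_]′)
  open import Function using (_∘_; id)
  open import Relation.Binary.PropositionalEquality
  open import Relation.Nullary using (contradiction; Dec; yes; no)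

  i*i≡∣i∣*∣i∣ : ∀ i → i ℤ.* i ≡ + (∣ i ∣ ℕ.* ∣ i ∣)
  i*i≡∣i∣*∣i∣ (+ n)    = ℤ.+◃n≡+n _
  i*i≡∣i∣*∣i∣ -[1+ n ] = ℤ.+◃n≡+n _

  b*b≡a*a*d⇒square : ∀ a b d → a ≢ 0 → b ℕ.* b ≡ a ℕ.* a ℕ.* d → ∃ λ r → d ≡ r ℕ.* r
  b*b≡a*a*d⇒square a b d a≢0 eq =
    b′ , sym (trans b′²≡a′²d (trans (cong (λ t → t ℕ.* t ℕ.* d) a′≡1) (ℕ.+-identityʳ d)))
    where
    g = gcd a b
    instance
      g≢0 : NonZero g
      g≢0 = ≢-nonZero (a≢0 ∘ gcd[m,n]≡0⇒m≡0)
      g*g≢0 : NonZero (g ℕ.* g)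
      g*g≢0 = ℕ.m*n≢0 g g
    a′ = a / g
    b′ = b / g
    b′²≡a′²d : b′ ℕ.* b′ ≡ a′ ℕ.* a′ ℕ.* d
    b′²≡a′²d = ℕ.*-cancelʳ-≡ _ _ (g ℕ.* g) (begin
      b′ ℕ.* b′ ℕ.* (g ℕ.* g)          ≡⟨ square-* b′ g ⟩
      (b′ ℕ.* g) ℕ.* (b′ ℕ.* g)        ≡⟨ cong₂ ℕ._*_ (m/n*n≡m (gcd[m,n]∣n a b)) (m/n*n≡m (gcd[m,n]∣n a b)) ⟩
      b ℕ.* b                          ≡⟨ eq ⟩
      a ℕ.* a ℕ.* d                    ≡⟨ cong (λ t → t ℕ.* t ℕ.* d) (m/n*n≡m (gcd[m,n]∣m a b)) ⟨
      (a′ ℕ.* g) ℕ.* (a′ ℕ.* g) ℕ.* d  ≡⟨ square-*-* a′ g d ⟩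
      a′ ℕ.* a′ ℕ.* d ℕ.* (g ℕ.* g)    ∎)
      where
      open ≡-Reasoning
      square-* : ∀ x g → x ℕ.* x ℕ.* (g ℕ.* g) ≡ (x ℕ.* g) ℕ.* (x ℕ.* g)
      square-* = ℕ-solve-∀
      square-*-* : ∀ x g d → (x ℕ.* g) ℕ.* (x ℕ.* g) ℕ.* d ≡ x ℕ.* x ℕ.* d ℕ.* (g ℕ.* g)
      square-*-* = ℕ-solve-∀
    a′∣b′*b′ : a′ ℕ.∣ b′ ℕ.* b′
    a′∣b′*b′ = ℕ.divides (a′ ℕ.* d) (trans b′²≡a′²d (regroup a′ d))
      where
      regroup : ∀ a d → a ℕ.* a ℕ.* d ≡ a ℕ.* d ℕ.* a
      regroup = ℕ-solve-∀
    a′≡1 : a′ ≡ 1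
    a′≡1 = coprime-/gcd a b (ℕ.∣-refl , coprime-divisor (coprime-/gcd a b) a′∣b′*b′)

  IsZeroRealℤ[B,0]⇒B≡0 : ∀ {D B} → IsZeroRealℤ D (B , + 0) → B ≡ + 0
  IsZeroRealℤ[B,0]⇒B≡0 {D} {B} (B*B≡0 , _) = [ id , id ]′ (ℤ.i*j≡0⇒i≡0∨j≡0 B (trans B*B≡0 (ℤ.*-zeroˡ D)))

  IsZeroRealℤ⇒square : ∀ {D B A} → A ≢ + 0 → IsZeroRealℤ D (B , A) → ∃ λ r → D ≡ + r ℤ.* + r
  IsZeroRealℤ⇒square {+ d} {B} {A} A≢0 (B*B≡A*A*D , _) =
    let r , d≡r*r = b*b≡a*a*d⇒square ∣ A ∣ ∣ B ∣ d (A≢0 ∘ ℤ.∣i∣≡0⇒i≡0) (ℤ.+-injective ∣B∣²≡∣A∣²d)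
    in r , trans (cong +_ d≡r*r) (ℤ.pos-* r r)
    where
    open ≡-Reasoning
    ∣B∣²≡∣A∣²d : + (∣ B ∣ ℕ.* ∣ B ∣) ≡ + (∣ A ∣ ℕ.* ∣ A ∣ ℕ.* d)
    ∣B∣²≡∣A∣²d = begin
      + (∣ B ∣ ℕ.* ∣ B ∣)          ≡⟨ i*i≡∣i∣*∣i∣ B ⟨
      B ℤ.* B                      ≡⟨ B*B≡A*A*D ⟩
      A ℤ.* A ℤ.* + d              ≡⟨ cong (ℤ._* + d) (i*i≡∣i∣*∣i∣ A) ⟩
      + (∣ A ∣ ℕ.* ∣ A ∣) ℤ.* + d   ≡⟨ ℤ.pos-* (∣ A ∣ ℕ.* ∣ A ∣) d ⟨
      + (∣ A ∣ ℕ.* ∣ A ∣ ℕ.* d)     ∎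
  IsZeroRealℤ⇒square {D = -[1+ d ]} {B} {A} A≢0 (B*B≡A*A*D , _) =
    ⊥-elim (square≢negative ∣ A ∣ (A≢0 ∘ ℤ.∣i∣≡0⇒i≡0)
      (trans (sym (i*i≡∣i∣*∣i∣ B)) (trans B*B≡A*A*D (cong (ℤ._* -[1+ d ]) (i*i≡∣i∣*∣i∣ A)))))
    where
    square≢negative : ∀ x {y} → x ≢ 0 → + y ≢ + (x ℕ.* x) ℤ.* -[1+ d ]
    square≢negative zero    x≢0 = ⊥-elim (x≢0 refl)
    square≢negative (suc x) _   ()

  module Norm (D : ℤ) where

    open Adjoin√ ℤ.+-*-commutativeRing D
    open import Algebra.Properties.Semiring.Exp (CommutativeRing.semiring +-*-commutativeRing) using (_^_)

    norm : ℤ × ℤ → ℤ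
    norm (a , b) = a ℤ.* a ℤ.- b ℤ.* b ℤ.* D

    norm-cong : ∀ {u v} → u ≋ v → norm u ≡ norm v
    norm-cong (refl , refl) = refl

    norm-* : ∀ u v → norm (u ⊛ v) ≡ norm u ℤ.* norm v
    norm-* (a , b) (c , d) = multiplicative a b c d D
      where
      multiplicative : ∀ a b c d D →
        (a ℤ.* c ℤ.+ b ℤ.* d ℤ.* D) ℤ.* (a ℤ.* c ℤ.+ b ℤ.* d ℤ.* D)
          ℤ.- (a ℤ.* d ℤ.+ b ℤ.* c) ℤ.* (a ℤ.* d ℤ.+ b ℤ.* c) ℤ.* D
        ≡ (a ℤ.* a ℤ.- b ℤ.* b ℤ.* D) ℤ.* (c ℤ.* c ℤ.- d ℤ.* d ℤ.* D)
      multiplicative = solve-∀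

    norm-fromℤ : ∀ a → norm (fromℤ a) ≡ a ℤ.* a
    norm-fromℤ a = ℤ.+-identityʳ (a ℤ.* a)

    norm-^ : ∀ u n → norm (u ^ n) ≡ norm u ^ℤ n
    norm-^ u zero    = ℤ.+-identityʳ (+ 1)
    norm-^ u (suc n) = trans (norm-* u (u ^ n)) (cong (norm u ℤ.*_) (norm-^ u n))

  module Evaluation (D : ℤ) (r : ℕ) (D≡r*r : D ≡ + r ℤ.* + r) where

    open Adjoin√ ℤ.+-*-commutativeRing D

    evaluate : ℤ × ℤ → ℤ
    evaluate (a , b) = a ℤ.+ b ℤ.* + r

    evaluate-+ : ∀ u v → evaluate (u ⊕ v) ≡ evaluate u ℤ.+ evaluate v
    evaluate-+ (a , b) (c , d) = additive a b c d (+ r)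
      where
      additive : ∀ a b c d R → a ℤ.+ c ℤ.+ (b ℤ.+ d) ℤ.* R ≡ a ℤ.+ b ℤ.* R ℤ.+ (c ℤ.+ d ℤ.* R)
      additive = solve-∀

    evaluate-* : ∀ u v → evaluate (u ⊛ v) ≡ evaluate u ℤ.* evaluate v
    evaluate-* (a , b) (c , d) rewrite D≡r*r = multiplicative a b c d (+ r)
      where
      multiplicative : ∀ a b c d R →
        a ℤ.* c ℤ.+ b ℤ.* d ℤ.* (R ℤ.* R) ℤ.+ (a ℤ.* d ℤ.+ b ℤ.* c) ℤ.* R
          ≡ (a ℤ.+ b ℤ.* R) ℤ.* (c ℤ.+ d ℤ.* R)
      multiplicative = solve-∀

    evaluate-fromℤ : ∀ a → evaluate (fromℤ a) ≡ a
    evaluate-fromℤ a = trans (cong (λ t → a ℤ.+ t) (ℤ.*-zeroˡ (+ r))) (ℤ.+-identityʳ a)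

    IsZeroRealℤ⇒evaluate≡0 : ∀ {u} → IsZeroRealℤ D u → evaluate u ≡ + 0
    IsZeroRealℤ⇒evaluate≡0 {B , A} (B*B≡A*A*D , B*A≤0) =
      [ B≡Ar⇒B+Ar≡0 ∘ ℤ.i-j≡0⇒i≡j B Ar , id ]′ (ℤ.i*j≡0⇒i≡0∨j≡0 (B ℤ.- Ar) conjugates)
      where
      Ar = A ℤ.* + r
      conjugates : (B ℤ.- Ar) ℤ.* (B ℤ.+ Ar) ≡ + 0
      conjugates = begin
        (B ℤ.- Ar) ℤ.* (B ℤ.+ Ar)          ≡⟨ difference-of-squares B A (+ r) ⟩
        B ℤ.* B ℤ.- A ℤ.* A ℤ.* (+ r ℤ.* + r)
          ≡⟨ cong (ℤ._- A ℤ.* A ℤ.* (+ r ℤ.* + r)) (trans B*B≡A*A*D (cong (A ℤ.* A ℤ.*_) D≡r*r)) ⟩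
        A ℤ.* A ℤ.* (+ r ℤ.* + r) ℤ.- A ℤ.* A ℤ.* (+ r ℤ.* + r)
          ≡⟨ ℤ.+-inverseʳ (A ℤ.* A ℤ.* (+ r ℤ.* + r)) ⟩
        + 0                                ∎
        where
        open ≡-Reasoning
        difference-of-squares : ∀ B A R →
          (B ℤ.- A ℤ.* R) ℤ.* (B ℤ.+ A ℤ.* R) ≡ B ℤ.* B ℤ.- A ℤ.* A ℤ.* (R ℤ.* R)
        difference-of-squares = solve-∀
      -- If B = A r then B A = A² r is both ≤ 0 and ≥ 0.
      B≡Ar⇒B+Ar≡0 : B ≡ Ar → B ℤ.+ Ar ≡ + 0
      B≡Ar⇒B+Ar≡0 B≡Ar = trans (cong (ℤ._+ Ar) (trans B≡Ar Ar≡0)) (cong (λ t → + 0 ℤ.+ t) Ar≡0)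
        where
        A*Ar≡A*A*r : A ℤ.* Ar ≡ + (∣ A ∣ ℕ.* ∣ A ∣ ℕ.* r)
        A*Ar≡A*A*r = trans (regroup A (+ r))
          (trans (cong (ℤ._* + r) (i*i≡∣i∣*∣i∣ A)) (sym (ℤ.pos-* (∣ A ∣ ℕ.* ∣ A ∣) r)))
          where
          regroup : ∀ A R → A ℤ.* (A ℤ.* R) ≡ A ℤ.* A ℤ.* R
          regroup = solve-∀
        A*Ar≡0 : A ℤ.* Ar ≡ + 0
        A*Ar≡0 = ℤ.≤-antisym (subst (ℤ._≤ + 0) (trans (cong (ℤ._* A) B≡Ar) (ℤ.*-comm Ar A)) B*A≤0)
                             (subst (+ 0 ℤ.≤_) (sym A*Ar≡A*A*r) (ℤ.+≤+ ℕ.z≤n))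
        Ar≡0 : Ar ≡ + 0
        Ar≡0 = [ (λ A≡0 → trans (cong (ℤ._* + r) A≡0) (ℤ.*-zeroˡ (+ r))) , id ]′ (ℤ.i*j≡0⇒i≡0∨j≡0 A A*Ar≡0)

  ≤-by-bounded-denominators : ∀ {N K W} → N ≢ + 0 → W ≢ + 0 →
    (∀ n → ∃ λ w → N ^ℤ n ℤ.* W ≡ K ^ℤ n ℤ.* w) → ∣ K ∣ ℕ.≤ ∣ N ∣
  ≤-by-bounded-denominators {N} {K} {W} N≢0 W≢0 bounded =
    pow∣pow*⇒≤ ∣ N ∣ ∣ W ∣ {{≢-nonZero (N≢0 ∘ ℤ.∣i∣≡0⇒i≡0)}} {{≢-nonZero (W≢0 ∘ ℤ.∣i∣≡0⇒i≡0)}} divides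
    where
    divides : ∀ n → ∣ K ∣ ℕ.^ n ℕ.∣ ∣ N ∣ ℕ.^ n ℕ.* ∣ W ∣
    divides n = let w , eq = bounded n in ℕ.divides ∣ w ∣ (begin
      ∣ N ∣ ℕ.^ n ℕ.* ∣ W ∣      ≡⟨ cong (ℕ._* ∣ W ∣) (abs-^ N n) ⟨
      ∣ N ^ℤ n ∣ ℕ.* ∣ W ∣        ≡⟨ ℤ.abs-* (N ^ℤ n) W ⟨
      ∣ N ^ℤ n ℤ.* W ∣            ≡⟨ cong ∣_∣ eq ⟩
      ∣ K ^ℤ n ℤ.* w ∣            ≡⟨ ℤ.abs-* (K ^ℤ n) w ⟩
      ∣ K ^ℤ n ∣ ℕ.* ∣ w ∣        ≡⟨ cong (ℕ._* ∣ w ∣) (abs-^ K n) ⟩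
      ∣ K ∣ ℕ.^ n ℕ.* ∣ w ∣       ≡⟨ ℕ.*-comm (∣ K ∣ ℕ.^ n) ∣ w ∣ ⟩
      ∣ w ∣ ℕ.* ∣ K ∣ ℕ.^ n       ∎)
      where open ≡-Reasoning

  -- Shifting v by its quotient by K leaves the remainder, which the bound forces to vanish.
  ∣-by-bounded-shifts : ∀ v k {W} → W ≢ + 0 →
    (∀ s n → ∃ λ w → (v ℤ.+ s ℤ.* + suc k) ^ℤ n ℤ.* W ≡ (+ suc k) ^ℤ n ℤ.* w) → + suc k ∣ v
  ∣-by-bounded-shifts v k {W} W≢0 bounded = by-remainder (v %ℕ suc k) refl
    where
    K = + suc k
    q = v /ℕ suc k
    v≡ρ+qK : ∀ {ρ} → v %ℕ suc k ≡ ρ → v ≡ + ρ ℤ.+ q ℤ.* K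
    v≡ρ+qK refl = a≡a%ℕn+[a/ℕn]*n v (suc k)
    by-remainder : ∀ ρ → v %ℕ suc k ≡ ρ → K ∣ v
    by-remainder zero    v%K≡0 =
      ℕ.divides ∣ q ∣ (trans (cong ∣_∣ (trans (v≡ρ+qK v%K≡0) (ℤ.+-identityˡ (q ℤ.* K)))) (ℤ.abs-* q K))
    by-remainder (suc ρ) v%K≡ρ = contradiction (≤-by-bounded-denominators (λ ()) W≢0 shifted)
                                               (ℕ.<⇒≱ (subst (ℕ._< suc k) v%K≡ρ (n%ℕd<d v (suc k))))
      where
      shifted : ∀ n → ∃ λ w → (+ suc ρ) ^ℤ n ℤ.* W ≡ K ^ℤ n ℤ.* w
      shifted n = let w , eq = bounded (ℤ.- q) n in
        w , trans (cong (λ t → t ^ℤ n ℤ.* W)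
                        (sym (trans (cong (ℤ._+ ℤ.- q ℤ.* K) (v≡ρ+qK v%K≡ρ)) (cancel (+ suc ρ) q K))))
                  eq
        where
        cancel : ∀ ρ q K → ρ ℤ.+ q ℤ.* K ℤ.+ ℤ.- q ℤ.* K ≡ ρ
        cancel = solve-∀

  ^ℤ-≢0 : ∀ {i} n → i ≢ + 0 → i ^ℤ n ≢ + 0
  ^ℤ-≢0 zero    i≢0 ()
  ^ℤ-≢0 {i} (suc n) i≢0 i^n≡0 = [ i≢0 , ^ℤ-≢0 n i≢0 ]′ (ℤ.i*j≡0⇒i≡0∨j≡0 i i^n≡0)

  module _ {D : ℤ} (k : ℕ) where

    private
      K = + suc k

    -- With D = r² the substitution √D ↦ r is a ring map, so (c + e r) / K is a rational algebraic integer.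
    rational-integral⇒∣ : ∀ {r c e} → D ≡ + r ℤ.* + r → ∀ cs → IsZeroRealℤ D (scaled D k c e cs) →
                          K ∣ c ℤ.+ e ℤ.* + r
    rational-integral⇒∣ {r} {c} {e} D≡r*r cs zero-scaled =
      ∣-by-bounded-shifts v k (^ℤ-≢0 (length cs) (λ ()))
        (shifted-bounded-denominators ℤ.+-*-commutativeRing K v {cs} root)
      where
      open Evaluation D r D≡r*r
      open RingHomomorphism (Adjoin√.+-*-commutativeRing ℤ.+-*-commutativeRing D) ℤ.+-*-commutativeRing
        evaluate evaluate-+ evaluate-* refl
      open ScaledMonic using (scaledMonic; shifted-bounded-denominators)
      v = c ℤ.+ e ℤ.* + r
      root : scaledMonic ℤ.+-*-commutativeRing K v cs ≡ + 0
      root = begin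
        scaledMonic ℤ.+-*-commutativeRing K v cs
          ≡⟨ cong₂ (λ K′ as → scaledMonic ℤ.+-*-commutativeRing K′ v as) (sym (evaluate-fromℤ K))
               (trans (sym (map-id cs)) (trans (map-cong (sym ∘ evaluate-fromℤ) cs) (map-∘ cs))) ⟩
        scaledMonic ℤ.+-*-commutativeRing (evaluate (fromℤ K)) v (map evaluate (map fromℤ cs))
          ≡⟨ scaledMonic-homo (fromℤ K) (c , e) (map fromℤ cs) ⟨
        evaluate (scaled D k c e cs)
          ≡⟨ IsZeroRealℤ⇒evaluate≡0 {scaled D k c e cs} zero-scaled ⟩
        + 0 ∎
        where open ≡-Reasoning

    -- Here the relation holds in ℤ[√D] itself, and its norms satisfy Nⁿ K^{2M} = K^{2n} · norm w.
    irrational-integral⇒≤ : ∀ {c} cs → IsZeroRealℤ D (scaled D k c (+ 1) cs) → proj₂ (scaled D k c (+ 1) cs) ≡ + 0 →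
      c ℤ.* c ℤ.- D ≢ + 0 → suc k ℕ.* suc k ℕ.≤ ∣ c ℤ.* c ℤ.- D ∣
    irrational-integral⇒≤ {c} cs zero-scaled A≡0 N≢0 =
      ≤-by-bounded-denominators N≢0 (^ℤ-≢0 M (λ ())) norms-bounded
      where
      open Adjoin√ ℤ.+-*-commutativeRing D using (_⊛_)
      open Norm D
      M = length (map fromℤ cs)
      norm[c,1] : norm (c , + 1) ≡ c ℤ.* c ℤ.- D
      norm[c,1] = cong (λ t → c ℤ.* c ℤ.- t) (ℤ.*-identityˡ D)
      open ScaledMonic (Adjoin√.+-*-commutativeRing ℤ.+-*-commutativeRing D) (fromℤ K) (c , + 1)
        using (bounded-denominators; _^_)
      B≡0 : proj₁ (scaled D k c (+ 1) cs) ≡ + 0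
      B≡0 = IsZeroRealℤ[B,0]⇒B≡0 {D}
        (subst (λ A → IsZeroRealℤ D (proj₁ (scaled D k c (+ 1) cs) , A)) A≡0 zero-scaled)
      norms-bounded : ∀ n → ∃ λ w → (c ℤ.* c ℤ.- D) ^ℤ n ℤ.* (K ℤ.* K) ^ℤ M ≡ (K ℤ.* K) ^ℤ n ℤ.* w
      norms-bounded n = let w , eq = bounded-denominators {map fromℤ cs} (B≡0 , A≡0) n in norm w , (begin
        (c ℤ.* c ℤ.- D) ^ℤ n ℤ.* (K ℤ.* K) ^ℤ M            ≡⟨ cong₂ (λ a b → a ^ℤ n ℤ.* b ^ℤ M) norm[c,1] (norm-fromℤ K) ⟨
        norm (c , + 1) ^ℤ n ℤ.* norm (fromℤ K) ^ℤ M      ≡⟨ cong₂ ℤ._*_ (norm-^ (c , + 1) n) (norm-^ (fromℤ K) M) ⟨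
        norm ((c , + 1) ^ n) ℤ.* norm (fromℤ K ^ M)      ≡⟨ norm-* ((c , + 1) ^ n) (fromℤ K ^ M) ⟨
        norm ((c , + 1) ^ n ⊛ fromℤ K ^ M)               ≡⟨ norm-cong eq ⟩
        norm (fromℤ K ^ n ⊛ w)                           ≡⟨ norm-* (fromℤ K ^ n) w ⟩
        norm (fromℤ K ^ n) ℤ.* norm w                    ≡⟨ cong (ℤ._* norm w) (norm-^ (fromℤ K) n) ⟩
        norm (fromℤ K) ^ℤ n ℤ.* norm w                   ≡⟨ cong (λ a → a ^ℤ n ℤ.* norm w) (norm-fromℤ K) ⟩
        (K ℤ.* K) ^ℤ n ℤ.* norm w                          ∎)
        where open ≡-Reasoning

    -- Either the relation for (c + √D) / K holds in ℤ[√D], or D = r² and K divides both c + r and c − r.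
    conjugates-integral⇒≤ : ∀ {c} →
      IsAlgebraicInteger D (c ℚ./ suc k , + 1 ℚ./ suc k) → IsAlgebraicInteger D (c ℚ./ suc k , ℤ.- + 1 ℚ./ suc k) →
      c ℤ.* c ℤ.- D ≢ + 0 → suc k ℕ.* suc k ℕ.≤ ∣ c ℤ.* c ℤ.- D ∣
    conjugates-integral⇒≤ {c} (cs₊ , zero₊) (cs₋ , zero₋) N≢0 = by-cases (proj₂ (scaled D k c (+ 1) cs₊) ℤ.≟ + 0)
      where
      Z₊ = IsZeroRealℤ-scaled D k c (+ 1) cs₊ zero₊
      Z₋ = IsZeroRealℤ-scaled D k c (ℤ.- + 1) cs₋ zero₋
      by-cases : Dec (proj₂ (scaled D k c (+ 1) cs₊) ≡ + 0) → suc k ℕ.* suc k ℕ.≤ ∣ c ℤ.* c ℤ.- D ∣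
      by-cases (yes A≡0) = irrational-integral⇒≤ cs₊ Z₊ A≡0 N≢0
      by-cases (no A≢0)  = ℕ.∣⇒≤ {{≢-nonZero (N≢0 ∘ ℤ.∣i∣≡0⇒i≡0)}}
        (subst (suc k ℕ.* suc k ℕ.∣_) ∣product∣
          (ℕ.*-pres-∣ (rational-integral⇒∣ D≡r*r cs₊ Z₊) (rational-integral⇒∣ D≡r*r cs₋ Z₋)))
        where
        D-square = IsZeroRealℤ⇒square {D} {proj₁ (scaled D k c (+ 1) cs₊)} A≢0 Z₊
        r = proj₁ D-square
        D≡r*r = proj₂ D-square
        ∣product∣ : ∣ c ℤ.+ + 1 ℤ.* + r ∣ ℕ.* ∣ c ℤ.+ ℤ.- + 1 ℤ.* + r ∣ ≡ ∣ c ℤ.* c ℤ.- D ∣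
        ∣product∣ = trans (sym (ℤ.abs-* (c ℤ.+ + 1 ℤ.* + r) (c ℤ.+ ℤ.- + 1 ℤ.* + r)))
          (cong ∣_∣ (trans (difference-of-squares c (+ r)) (cong (λ t → c ℤ.* c ℤ.- t) (sym D≡r*r))))
          where
          difference-of-squares : ∀ c r → (c ℤ.+ + 1 ℤ.* r) ℤ.* (c ℤ.+ ℤ.- + 1 ℤ.* r) ≡ c ℤ.* c ℤ.- r ℤ.* r
          difference-of-squares = solve-∀

open IntegralityBounds

module EigenvalueConditions where

  open import Data.Nat as ℕ using (ℕ; zero; suc; _≤_; _<_; _∸_)
  import Data.Nat.Properties as ℕ
  open import Data.Nat.Divisibility using (_∣_)
  open import Data.Integer as ℤ using (ℤ; +_; ∣_∣)
  import Data.Integer.Properties as ℤ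
  open import Data.Integer.Tactic.RingSolver using (solve-∀)
  open import Data.Product using (_,_)
  open import Function using (_∘_)
  open import Relation.Binary.PropositionalEquality

  +m-+n≡+[m∸n] : ∀ {m n} → n ≤ m → + m ℤ.- + n ≡ + (m ∸ n)
  +m-+n≡+[m∸n] {m} {n} n≤m = trans (ℤ.m-n≡m⊖n m n) (ℤ.⊖-≥ n≤m)

  -- (λ − μ + √D)(λ − μ − √D) = (λ − μ)² − D = 4 (k − μ).
  k²≤4[k∸μ] : ∀ {k l m} → m < suc k →
    IsAlgebraicInteger (disc (suc k) l m) (twoThetaPlusOverK (suc k) l m) →
    IsAlgebraicInteger (disc (suc k) l m) (twoThetaMinusOverK (suc k) l m) →
    suc k ℕ.* suc k ≤ 4 ℕ.* (suc k ∸ m)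
  k²≤4[k∸μ] {k} {l} {m} m<k integral₊ integral₋ =
    subst (suc k ℕ.* suc k ≤_) (cong ∣_∣ N≡4[k∸μ])
      (conjugates-integral⇒≤ k {c} integral₊ integral₋
        (4*n≢0 (ℕ.m<n⇒0<n∸m m<k) ∘ ℤ.+-injective ∘ trans (sym N≡4[k∸μ])))
    where
    c = + l ℤ.- + m
    4*n≢0 : ∀ {n} → 0 < n → 4 ℕ.* n ≢ 0
    4*n≢0 {suc n} _ ()
    N≡4[k∸μ] : c ℤ.* c ℤ.- disc (suc k) l m ≡ + (4 ℕ.* (suc k ∸ m))
    N≡4[k∸μ] = trans (cancel c (+ 4 ℤ.* (+ suc k ℤ.- + m)))
                     (trans (cong (+ 4 ℤ.*_) (+m-+n≡+[m∸n] (ℕ.<⇒≤ m<k))) (sym (ℤ.pos-* 4 (suc k ∸ m))))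
      where
      cancel : ∀ c t → c ℤ.* c ℤ.- (c ℤ.* c ℤ.- t) ≡ t
      cancel = solve-∀

  k∣2[k∸λ] : ∀ {k l m} → m ≡ suc k → l ≤ suc k →
    IsAlgebraicInteger (disc (suc k) l m) (twoThetaMinusOverK (suc k) l m) →
    suc k ∣ 2 ℕ.* (suc k ∸ l)
  k∣2[k∸λ] {k} {l} refl l≤k (cs , zero-E) =
    subst (suc k ∣_) ∣c-r∣≡2r (rational-integral⇒∣ k D≡r*r cs (IsZeroRealℤ-scaled D k c (ℤ.- + 1) cs zero-E))
    where
    D = disc (suc k) l (suc k)
    c = + l ℤ.- + suc k
    r = suc k ∸ l
    ∣c-r∣≡2r : ∣ c ℤ.+ ℤ.- + 1 ℤ.* + r ∣ ≡ 2 ℕ.* r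
    ∣c-r∣≡2r = begin
      ∣ c ℤ.+ ℤ.- + 1 ℤ.* + r ∣                       ≡⟨ cong (λ t → ∣ c ℤ.+ ℤ.- + 1 ℤ.* t ∣) (+m-+n≡+[m∸n] l≤k) ⟨
      ∣ c ℤ.+ ℤ.- + 1 ℤ.* (+ suc k ℤ.- + l) ∣         ≡⟨ cong ∣_∣ (twice (+ l) (+ suc k)) ⟩
      ∣ ℤ.- (+ 2 ℤ.* (+ suc k ℤ.- + l)) ∣             ≡⟨ ℤ.∣-i∣≡∣i∣ (+ 2 ℤ.* (+ suc k ℤ.- + l)) ⟩
      ∣ + 2 ℤ.* (+ suc k ℤ.- + l) ∣                   ≡⟨ cong (λ t → ∣ + 2 ℤ.* t ∣) (+m-+n≡+[m∸n] l≤k) ⟩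
      ∣ + 2 ℤ.* + r ∣                                 ≡⟨ ℤ.abs-* (+ 2) (+ r) ⟩
      2 ℕ.* r                                         ∎
      where
      open ≡-Reasoning
      twice : ∀ l K → (l ℤ.- K) ℤ.+ ℤ.- + 1 ℤ.* (K ℤ.- l) ≡ ℤ.- (+ 2 ℤ.* (K ℤ.- l))
      twice = solve-∀
    D≡r*r : D ≡ + r ℤ.* + r
    D≡r*r = trans (perfect-square (+ l) (+ suc k)) (cong (λ t → t ℤ.* t) (+m-+n≡+[m∸n] l≤k))
      where
      perfect-square : ∀ l K → (l ℤ.- K) ℤ.* (l ℤ.- K) ℤ.- + 4 ℤ.* (K ℤ.- K) ≡ (K ℤ.- l) ℤ.* (K ℤ.- l)
      perfect-square = solve-∀

open EigenvalueConditions

module Counting where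

  open import Data.Bool using (Bool; true; false; not; _∧_; if_then_else_)
  open import Data.Bool.Properties using (∧-comm; ∧-assoc; ∧-identityʳ; ∧-zeroʳ)
  open import Data.Fin using (Fin; zero; suc; _≟_)
  open import Data.List using (tabulate; map)
  open import Data.List.Properties using (map-tabulate)
  open import Data.Nat hiding (_≟_)
  import Data.Nat.ListAction as List
  open import Data.Nat.Properties hiding (_≟_)
  open import Data.Nat.Properties using () renaming (_≟_ to _≟ℕ_)
  open import Algebra.Properties.Semiring.Sum +-*-semiring
    using (sum; sum-cong-≗; sum-replicate-zero; ∑-comm; ∑-distrib-+; *-distribˡ-sum; *-distribʳ-sum)
  open import Data.Product using (_×_; _,_)
  open import Data.Sum using (_⊎_; inj₁; inj₂)
  open import Function using (_∘_; id)
  open import Relation.Binary.PropositionalEquality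
  open import Relation.Nullary.Decidable using (does; yes; no)
  open import Relation.Nullary.Negation using (¬_; contradiction)

  indicator : Bool → ℕ
  indicator b = if b then 1 else 0

  indicator-∧ : ∀ a b → indicator (a ∧ b) ≡ indicator a * indicator b
  indicator-∧ false b = refl
  indicator-∧ true  b = sym (+-identityʳ (indicator b))

  module _ {n : ℕ} where

    count≡sum : (P : Fin n → Bool) → count P ≡ sum (indicator ∘ P)
    count≡sum P = trans (cong List.sum (map-tabulate id (indicator ∘ P))) (sum-tabulate (indicator ∘ P))
      where
      sum-tabulate : ∀ {m} (f : Fin m → ℕ) → List.sum (tabulate f) ≡ sum f
      sum-tabulate {zero}  f = refl
      sum-tabulate {suc m} f = cong (f zero +_) (sum-tabulate (f ∘ suc))

    count-cong : ∀ {P Q : Fin n → Bool} → (∀ w → P w ≡ Q w) → count P ≡ count Q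
    count-cong {P} {Q} P≗Q = trans (count≡sum P) (trans (sum-cong-≗ (cong indicator ∘ P≗Q)) (sym (count≡sum Q)))

    count-split : ∀ (P Q : Fin n → Bool) → count P ≡ count (λ w → P w ∧ Q w) + count (λ w → P w ∧ not (Q w))
    count-split P Q = begin
      count P
        ≡⟨ count≡sum P ⟩
      sum (indicator ∘ P)
        ≡⟨ sum-cong-≗ (λ w → split (P w) (Q w)) ⟩
      sum (λ w → indicator (P w ∧ Q w) + indicator (P w ∧ not (Q w)))
        ≡⟨ ∑-distrib-+ (λ w → indicator (P w ∧ Q w)) (λ w → indicator (P w ∧ not (Q w))) ⟩
      sum (λ w → indicator (P w ∧ Q w)) + sum (λ w → indicator (P w ∧ not (Q w)))
        ≡⟨ cong₂ _+_ (count≡sum (λ w → P w ∧ Q w)) (count≡sum (λ w → P w ∧ not (Q w))) ⟨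
      count (λ w → P w ∧ Q w) + count (λ w → P w ∧ not (Q w))             ∎
      where
      open ≡-Reasoning
      split : ∀ a b → indicator a ≡ indicator (a ∧ b) + indicator (a ∧ not b)
      split false b     = refl
      split true  true  = refl
      split true  false = refl

    count-≡ : ∀ u → count (λ w → does (w ≟ u)) ≡ 1
    count-≡ u = trans (count≡sum (λ w → does (w ≟ u))) (sum-≡ u)
      where
      sum-≡ : ∀ {m} (u : Fin m) → sum (λ w → indicator (does (w ≟ u))) ≡ 1
      sum-≡ {suc m} zero    = cong suc (sum-replicate-zero m)
      sum-≡ {suc m} (suc u) = sum-≡ u

    count-true : count {n} (λ _ → true) ≡ n
    count-true = trans (count≡sum (λ _ → true)) (sum-1 n)
      where
      sum-1 : ∀ m → sum {m} (λ _ → 1) ≡ m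
      sum-1 zero    = refl
      sum-1 (suc m) = cong suc (sum-1 m)

    count-mono : ∀ {P Q : Fin n → Bool} → (∀ w → P w ≡ true → Q w ≡ true) → count P ≤ count Q
    count-mono {P} {Q} P⇒Q =
      subst₂ _≤_ (sym (count≡sum P)) (sym (count≡sum Q)) (sum-mono (λ w → indicator-mono (P⇒Q w)))
      where
      indicator-mono : ∀ {a b} → (a ≡ true → b ≡ true) → indicator a ≤ indicator b
      indicator-mono {false} _   = z≤n
      indicator-mono {true}  a⇒b rewrite a⇒b refl = ≤-refl
      sum-mono : ∀ {m} {f g : Fin m → ℕ} → (∀ w → f w ≤ g w) → sum f ≤ sum g
      sum-mono {zero}  f≤g = z≤n
      sum-mono {suc m} f≤g = +-mono-≤ (f≤g zero) (sum-mono (f≤g ∘ suc))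

    count-pos : ∀ {P : Fin n → Bool} u → P u ≡ true → 0 < count P
    count-pos {P} u Pu = subst (_≤ count P) (count-≡ u) (count-mono {λ w → does (w ≟ u)} ≟⇒P)
      where
      ≟⇒P : ∀ w → does (w ≟ u) ≡ true → P w ≡ true
      ≟⇒P w with w ≟ u
      ... | yes refl = λ _ → Pu
      ... | no _     = λ ()

    indicator-*-count : ∀ a (Q : Fin n → Bool) → indicator a * count Q ≡ sum (λ z → indicator (a ∧ Q z))
    indicator-*-count a Q = begin
      indicator a * count Q                          ≡⟨ cong (indicator a *_) (count≡sum Q) ⟩
      indicator a * sum (indicator ∘ Q)              ≡⟨ *-distribˡ-sum (indicator a) (indicator ∘ Q) ⟩
      sum (λ z → indicator a * indicator (Q z))      ≡⟨ sum-cong-≗ (λ z → indicator-∧ a (Q z)) ⟨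
      sum (λ z → indicator (a ∧ Q z))                ∎
      where open ≡-Reasoning

    sum-indicator-* : ∀ (P : Fin n → Bool) c → sum (λ w → indicator (P w) * c) ≡ count P * c
    sum-indicator-* P c = trans (sym (*-distribʳ-sum c (indicator ∘ P))) (cong (_* c) (sym (count≡sum P)))

  indicator-*-cong : ∀ a {x y} → (a ≡ true → x ≡ y) → indicator a * x ≡ indicator a * y
  indicator-*-cong false x≡y = refl
  indicator-*-cong true  x≡y = cong (1 *_) (x≡y refl)

  module StronglyRegular {n} {G : Graph n} {k l m} (srg : IsSRG G k l m) where

    open IsSRG srg

    nonNeighbour : Fin n → Fin n → Bool
    nonNeighbour u z = not (does (z ≟ u)) ∧ not (adj G u z)

    nonNeighbour-sound : ∀ {u z} → nonNeighbour u z ≡ true → u ≢ z × ¬ Adjacent G u z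
    nonNeighbour-sound {u} {z} nn with z ≟ u | adj G u z
    ... | no z≢u | false = z≢u ∘ sym , λ ()

    nonNeighbour-complete : ∀ {u z} → u ≢ z → ¬ Adjacent G u z → nonNeighbour u z ≡ true
    nonNeighbour-complete {u} {z} u≢z u≁z with z ≟ u | adj G u z
    ... | yes refl | _     = contradiction refl u≢z
    ... | no _     | true  = contradiction refl u≁z
    ... | no _     | false = refl

    vertex-partition : ∀ u → n ≡ suc (k + count (nonNeighbour u))
    vertex-partition u = begin
      n                                                       ≡⟨ count-true {n} ⟨
      count {n} (λ _ → true)                                    ≡⟨ count-split (λ _ → true) (adj G u) ⟩
      count (adj G u) + count (λ z → not (adj G u z))
        ≡⟨ cong₂ _+_ (regular u) (count-split (λ z → not (adj G u z)) (λ z → does (z ≟ u))) ⟩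
      k + (count (λ z → not (adj G u z) ∧ does (z ≟ u)) + count (λ z → not (adj G u z) ∧ not (does (z ≟ u))))
        ≡⟨ cong (k +_) (cong₂ _+_ (trans (count-cong only-u) (count-≡ u))
                                  (count-cong (λ z → ∧-comm (not (adj G u z)) (not (does (z ≟ u)))))) ⟩
      k + suc (count (nonNeighbour u))                        ≡⟨ +-suc k _ ⟩
      suc (k + count (nonNeighbour u))                        ∎
      where
      open ≡-Reasoning
      only-u : ∀ z → not (adj G u z) ∧ does (z ≟ u) ≡ does (z ≟ u)
      only-u z with z ≟ u
      ... | yes refl = cong (λ b → not b ∧ true) (irrefl G z)
      ... | no _     = ∧-zeroʳ _

    neighbour-partition : ∀ {u w} → Adjacent G u w → k ≡ suc (l + count (λ z → adj G w z ∧ nonNeighbour u z))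
    neighbour-partition {u} {w} u~w = begin
      k                                                        ≡⟨ regular w ⟨
      count (adj G w)                                          ≡⟨ count-split (adj G w) (λ z → does (z ≟ u)) ⟩
      count (λ z → adj G w z ∧ does (z ≟ u)) + count (λ z → adj G w z ∧ not (does (z ≟ u)))
        ≡⟨ cong₂ _+_ (trans (count-cong only-u) (count-≡ u))
                     (count-split (λ z → adj G w z ∧ not (does (z ≟ u))) (adj G u)) ⟩
      1 + (count (λ z → (adj G w z ∧ not (does (z ≟ u))) ∧ adj G u z)
           + count (λ z → (adj G w z ∧ not (does (z ≟ u))) ∧ not (adj G u z)))
        ≡⟨ cong suc (cong₂ _+_ (trans (count-cong common) (lambdaCond u w u~w))
                               (count-cong (λ z → ∧-assoc (adj G w z) (not (does (z ≟ u))) (not (adj G u z))))) ⟩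
      suc (l + count (λ z → adj G w z ∧ nonNeighbour u z))     ∎
      where
      open ≡-Reasoning
      only-u : ∀ z → adj G w z ∧ does (z ≟ u) ≡ does (z ≟ u)
      only-u z with z ≟ u
      ... | yes refl = trans (∧-identityʳ (adj G w z)) (trans (adj-sym G w z) u~w)
      ... | no _     = ∧-zeroʳ _
      common : ∀ z → (adj G w z ∧ not (does (z ≟ u))) ∧ adj G u z ≡ adj G u z ∧ adj G w z
      common z with z ≟ u
      ... | yes refl = trans (cong (_∧ adj G z z) (∧-zeroʳ (adj G w z))) (sym (cong (_∧ adj G w z) (irrefl G z)))
      ... | no _     = trans (cong (_∧ adj G u z) (∧-identityʳ (adj G w z))) (∧-comm (adj G w z) (adj G u z))

    -- Count the paths u ~ w ~ z with z a non-neighbour of u, first by w, then by z.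
    double-count : ∀ u → k * (k ∸ suc l) ≡ count (nonNeighbour u) * m
    double-count u = begin
      k * (k ∸ suc l)                                            ≡⟨ cong (_* (k ∸ suc l)) (regular u) ⟨
      count (adj G u) * (k ∸ suc l)                              ≡⟨ sum-indicator-* (adj G u) (k ∸ suc l) ⟨
      sum (λ w → indicator (adj G u w) * (k ∸ suc l))            ≡⟨ sum-cong-≗ (λ w → indicator-*-cong (adj G u w) (onward w)) ⟩
      sum (λ w → indicator (adj G u w) * count (λ z → adj G w z ∧ nonNeighbour u z))
        ≡⟨ sum-cong-≗ (λ w → indicator-*-count (adj G u w) (λ z → adj G w z ∧ nonNeighbour u z)) ⟩
      sum (λ w → sum (λ z → indicator (adj G u w ∧ (adj G w z ∧ nonNeighbour u z))))
        ≡⟨ ∑-comm (λ w z → indicator (adj G u w ∧ (adj G w z ∧ nonNeighbour u z))) ⟩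
      sum (λ z → sum (λ w → indicator (adj G u w ∧ (adj G w z ∧ nonNeighbour u z))))
        ≡⟨ sum-cong-≗ (λ z → trans (sum-cong-≗ (rearrange z))
                                   (sym (indicator-*-count (nonNeighbour u z) (λ w → adj G u w ∧ adj G z w)))) ⟩
      sum (λ z → indicator (nonNeighbour u z) * count (λ w → adj G u w ∧ adj G z w))
        ≡⟨ sum-cong-≗ (λ z → indicator-*-cong (nonNeighbour u z) (backward z)) ⟩
      sum (λ z → indicator (nonNeighbour u z) * m)               ≡⟨ sum-indicator-* (nonNeighbour u) m ⟩
      count (nonNeighbour u) * m                                 ∎
      where
      open ≡-Reasoning
      onward : ∀ w → adj G u w ≡ true → k ∸ suc l ≡ count (λ z → adj G w z ∧ nonNeighbour u z)
      onward w u~w = trans (cong (_∸ suc l) (neighbour-partition u~w)) (m+n∸m≡n (suc l) _)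
      backward : ∀ z → nonNeighbour u z ≡ true → count (λ w → adj G u w ∧ adj G z w) ≡ m
      backward z nn = let u≢z , u≁z = nonNeighbour-sound nn in muCond u z u≢z u≁z
      rearrange : ∀ z w → indicator (adj G u w ∧ (adj G w z ∧ nonNeighbour u z))
                        ≡ indicator (nonNeighbour u z ∧ (adj G u w ∧ adj G z w))
      rearrange z w = cong indicator (trans (cong (λ b → adj G u w ∧ (b ∧ nonNeighbour u z)) (adj-sym G w z))
                                            (rotate (adj G u w) (adj G z w) (nonNeighbour u z)))
        where
        rotate : ∀ a b c → a ∧ (b ∧ c) ≡ c ∧ (a ∧ b)
        rotate a b c = trans (sym (∧-assoc a b c)) (∧-comm (a ∧ b) c)

    ν : ℕ
    ν = n ∸ suc k

    ν≡ : ∀ u → ν ≡ count (nonNeighbour u)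
    ν≡ u = trans (cong (_∸ suc k) (vertex-partition u)) (m+n∸m≡n (suc k) _)

    n≡1+k+ν : n ≡ suc (k + ν)
    n≡1+k+ν = let u , _ = notComplete in trans (vertex-partition u) (cong (λ t → suc (k + t)) (sym (ν≡ u)))

    ν>0 : 0 < ν
    ν>0 = let u , v , u≢v , u≁v = notComplete in
      subst (0 <_) (sym (ν≡ u)) (count-pos v (nonNeighbour-complete u≢v u≁v))

    k[k∸1+λ]≡νμ : k * (k ∸ suc l) ≡ ν * m
    k[k∸1+λ]≡νμ = let u , _ = notComplete in trans (double-count u) (cong (_* m) (sym (ν≡ u)))

    λ<k : l < k
    λ<k = let _ , _ , u~w = notEmpty in subst (l <_) (sym (neighbour-partition u~w)) (s≤s (m≤m+n l _))

    μ≤k : m ≤ k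
    μ≤k = let u , v , u≢v , u≁v = notComplete in
      subst₂ _≤_ (muCond u v u≢v u≁v) (regular u) (count-mono (λ w → ∧-elimˡ (adj G u w)))
      where
      ∧-elimˡ : ∀ a {b} → a ∧ b ≡ true → a ≡ true
      ∧-elimˡ true _ = refl

    -- With μ = 0 no two vertices are at distance 2, so no walk leaves a closed neighbourhood.
    μ≡0⇒short-walk : m ≡ 0 → ∀ {u w} → Walk G u w → u ≡ w ⊎ Adjacent G u w
    μ≡0⇒short-walk μ≡0 here = inj₁ refl
    μ≡0⇒short-walk μ≡0 (step {u} {v} {w} u~v walk) with μ≡0⇒short-walk μ≡0 walk
    ... | inj₁ refl = inj₂ u~v
    ... | inj₂ v~w with u ≟ w | adj G u w in u~w
    ...   | yes u≡w | _     = inj₁ u≡w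
    ...   | no _    | true  = inj₂ refl
    ...   | no u≢w  | false = contradiction (count-pos v v∈N[u]∩N[w]) (<-irrefl (sym common≡0))
      where
      v∈N[u]∩N[w] : adj G u v ∧ adj G w v ≡ true
      v∈N[u]∩N[w] rewrite u~v | adj-sym G w v | v~w = refl
      common≡0 : commonNbrs G u w ≡ 0
      common≡0 = trans (muCond u w u≢w (λ u~w′ → contradiction (trans (sym u~w′) u~w) λ ())) μ≡0

    connected⇒μ>0 : Connected G → 0 < m
    connected⇒μ>0 connected with m ≟ℕ 0 | notComplete
    ... | no  μ≢0 | _ = n≢0⇒n>0 μ≢0
    ... | yes μ≡0 | u , v , u≢v , u≁v with μ≡0⇒short-walk μ≡0 (connected u v)
    ...   | inj₁ u≡v = contradiction u≡v u≢v
    ...   | inj₂ u~v = contradiction u~v u≁v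

open Counting

open import Data.Nat using (ℕ; zero; suc; _*_; _<_; _<?_)
open import Data.Nat.Properties using (≤-antisym; ≮⇒≥; <⇒≤)
open import Data.Product using (_×_)
open import Data.Sum as Sum using (_⊎_; inj₁; inj₂)
open import Relation.Binary.PropositionalEquality using (_≡_)
open import Relation.Nullary using (Dec; yes; no)
open import Relation.Nullary.Negation using (contradiction)

lemma3p5 : (n k l m : ℕ) (G : Graph n) → IsSRG G k l m → Connected G →
    IsAlgebraicInteger (disc k l m) (twoThetaPlusOverK k l m) →
    IsAlgebraicInteger (disc k l m) (twoThetaMinusOverK k l m) →
    (n ≡ 2 * k × l ≡ 0 × m ≡ k)
    ⊎ (n ≡ 3 * l × k ≡ 2 * l × m ≡ 2 * l)
    ⊎ (n ≡ 5 × k ≡ 2 × l ≡ 0 × m ≡ 1)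
lemma3p5 n zero l m G srg _ _ _ = contradiction (StronglyRegular.λ<k srg) λ ()
lemma3p5 n (suc k) l m G srg connected integral₊ integral₋ = by-cases (m <? suc k)
  where
  open StronglyRegular srg
  by-cases : Dec (m < suc k) → (n ≡ 2 * suc k × l ≡ 0 × m ≡ suc k)
                               ⊎ (n ≡ 3 * l × suc k ≡ 2 * l × m ≡ 2 * l)
                               ⊎ (n ≡ 5 × suc k ≡ 2 × l ≡ 0 × m ≡ 1)
  by-cases (yes μ<k) = inj₂ (inj₂ (params-μ<k n≡1+k+ν ν>0 k[k∸1+λ]≡νμ (connected⇒μ>0 connected) μ<k
                                               (k²≤4[k∸μ] μ<k integral₊ integral₋)))
  by-cases (no μ≮k)  =
    Sum.map₂ inj₁ (params-μ≡k μ≡k n≡1+k+ν k[k∸1+λ]≡νμ λ<k (k∣2[k∸λ] μ≡k (<⇒≤ λ<k) integral₋))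
    where
    μ≡k : m ≡ suc k
    μ≡k = ≤-antisym μ≤k (≮⇒≥ μ≮k)
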